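{- For every integer $r\geq 2$ there is a bijection $\Phi:\mathcal{P}_r\to\mathcal{A}_r$ which preserves weight and length, i.e. for every $(\mu,\lambda)\in\mathcal{P}_r$ the partition $\Phi(\mu,\lambda)$ has weight $|(\mu,\lambda)|$ and has the same length as $(\mu,\lambda)$.
   Context: Here a partition is a finite non-increasing sequence of non-negative integers (zero parts allowed); it is equivalently described by its multiplicity sequence $(f_u)_{u\geq 0}$, where $f_u$ is the number of parts equal to $u$ (finitely many $f_u$ are positive). Its weight is $\sum_{u\geq0} u f_u$ and its length is $\sum_{u\geq 0} f_u$ (the number of parts, zeros included). $\mathcal{A}_r$ is the set of partitions $(f_u)_{u\geq 0}$ with $f_0\leq r-1$ and $f_u+f_{u+1}\leq r-1$ for all $u\geq 0$. For integers $s_1\geq s_2\geq\cdots\geq s_{r-1}\geq 0$, set $s_0=\infty$, $s_r=0$, and let $\mu(s_1,\ldots,s_{r-1})$ be the partition with multiplicity sequence given by $(f_{2u},f_{2u+1})=(j,0)$ for all $j\in\{0,\ldots,r-1\}$ and all $u$ with $s_{j+1}\leq u<s_j$. Let $\mathcal{P}(s_1,\ldots,s_{r-1})$ be the set of sequences $\lambda=(\lambda_0,\ldots,\lambda_{s_1-1})$ of non-negative integers such that for each $j\in\{1,\ldots,r-1\}$ one has $\lambda_{s_{j+1}}\leq\lambda_{s_{j+1}+1}\leq\cdots\leq\lambda_{s_j-1}$. Let $\mathcal{P}_r=\bigsqcup_{s_1\geq\cdots\geq s_{r-1}\geq0}\{\mu(s_1,\ldots,s_{r-1})\}\times\mathcal{P}(s_1,\ldots,s_{r-1})$.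 The weight of $(\mu(s_1,\ldots,s_{r-1}),\lambda)\in\mathcal{P}_r$ is $|\mu(s_1,\ldots,s_{r-1})|+\lambda_0+\cdots+\lambda_{s_1-1}$ (where $|\mu|$ is the weight of the partition $\mu$), and its length is the length of $\mu(s_1,\ldots,s_{r-1})$, namely $s_1+\cdots+s_{r-1}$. -}

module Defs where

open import Data.Nat using (ℕ; zero; suc; _+_; _*_; _∸_; _≤_; _<_; _≥_; _≟_)
open import Data.List using (List; []; _∷_; length; filter; map; upTo; replicate; concatMap; _++_)
open import Data.Nat.ListAction using (sum)
open import Data.List.Relation.Unary.Linked using (Linked)
open import Data.Product using (Σ; _×_; proj₁; proj₂; _,_)
open import Relation.Binary.PropositionalEquality using (_≡_)

-- Partitions: finite non-increasing lists of natural numbers (zero parts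
-- allowed).  Weight = sum of parts, length = number of parts.

NonIncreasing : List ℕ → Set
NonIncreasing = Linked _≥_

mult : ℕ → List ℕ → ℕ
mult u xs = length (filter (_≟ u) xs)

weight : List ℕ → ℕ
weight = sum

IsA : ℕ → List ℕ → Set
IsA r xs = NonIncreasing xs
         × mult 0 xs ≤ r ∸ 1
         × (∀ u → mult u xs + mult (suc u) xs ≤ r ∸ 1)

A : ℕ → Set
A r = Σ (List ℕ) (IsA r)

-- The set P_r.
-- The list s = (s_1 , … , s_{r-1}); sAt s j = s_j for 1 ≤ j ≤ r-1 and
-- sAt s j = 0 for j ≥ r (i.e. s_r = 0).  (s_0 = ∞ is never needed.)

at : List ℕ → ℕ → ℕ
at []       _       = 0
at (x ∷ xs) zero    = x
at (x ∷ xs) (suc i) = at xs i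

sAt : List ℕ → ℕ → ℕ
sAt s zero    = 0   -- unused (s_0 = ∞)
sAt s (suc j) = at s j

IsP : ℕ → List ℕ → List ℕ → Set
IsP r s lam = length s ≡ r ∸ 1
            × NonIncreasing s
            × length lam ≡ sAt s 1
            × (∀ j → 1 ≤ j → j ≤ r ∸ 1 →
                 ∀ i → sAt s (suc j) ≤ i → suc i < sAt s j →
                 at lam i ≤ at lam (suc i))

P : ℕ → Set
P r = Σ (List ℕ × List ℕ) λ p → IsP r (proj₁ p) (proj₂ p)

range : ℕ → ℕ → List ℕ
range lo hi = map (lo +_) (upTo (hi ∸ lo))

next : List ℕ → ℕ
next []      = 0
next (b ∷ _) = b

-- The parts of μ(s_1,…,s_{r-1}): for each j ∈ {1,…,r-1} and each u with
-- s_{j+1} ≤ u < s_j, j copies of the part 2u (odd parts have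
-- multiplicity 0; j = 0 contributes nothing).
muParts : ℕ → List ℕ → List ℕ
muParts j []         = []
muParts j (a ∷ rest) =
  concatMap (λ u → replicate j (2 * u)) (range (next rest) a)
  ++ muParts (suc j) rest

mu : List ℕ → List ℕ
mu s = muParts 1 s

weightP : ∀ r → P r → ℕ
weightP _ ((s , lam) , _) = weight (mu s) + sum lam

lengthP : ∀ r → P r → ℕ
lengthP _ ((s , lam) , _) = length (mu s)

{-# OPTIONS --safe #-}
-- A partition in A_r is the same as its multiplicity word (f₀, f₁, …), a
-- finitely supported sequence whose adjacent sums are at most K = r − 1.
-- Read greedily, a K-word splits into letters and clusters, a cluster being
-- two adjacent entries (K − b, b); the letters form a (K − 1)-word.
-- Conversely, clusters can be inserted into a (K − 1)-word w wherever their
-- value b fits between the neighbouring letters.  Numbering all these places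
-- consecutively, insertion becomes a bijection from pairs (non-decreasing
-- list ν of positions, w) to K-words; it adds aK parts of total size
-- Ka(a − 1) + Σν + 2a|w|, where a = length ν and |w| is the number of parts
-- of w.  Iterating from level K down to 1, a K-word corresponds to K
-- non-decreasing lists, namely the blocks of λ on the intervals
-- [s_{j+1}, s_j), and the sizes add up to |μ(s)| + Σλ, since
-- |μ(s)| = Σⱼ sⱼ(sⱼ − 1).
module Submission where

open import Data.Nat using (ℕ; zero; suc; _+_; _*_; _∸_; _≤_; _<_; z≤n; s≤s; _≟_; _<?_; _≤?_)
open import Data.Nat.Properties
open import Algebra.Properties.CommutativeSemigroup +-commutativeSemigroup using (x∙yz≈y∙xz)
open import Data.Nat.Tactic.RingSolver using (solve-∀)
open import Data.Nat.ListAction using (sum)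
open import Data.Nat.ListAction.Properties using (sum-++)
open import Data.List using (List; []; _∷_; map; length; _++_; replicate; filter; applyUpTo; concatMap; reverse; _∷ʳ_; take; drop)
open import Data.List.Properties using (filter-++; filter-accept; filter-reject; length-++; length-map; length-replicate; length-reverse; length-take; length-drop; length-applyUpTo; take++drop≡id; map-++; map-upTo; applyUpTo-∷ʳ; unfold-reverse; reverse-involutive; ++-assoc; ++-identityʳ)
import Data.List.Relation.Unary.Linked as Linked
open import Data.List.Relation.Unary.Linked using (Linked; []; [-]; _∷_)
open import Data.List.Relation.Unary.All using (All; []; _∷_)
open import Data.List.Relation.Unary.All.Properties using (∷ʳ⁺)
open import Data.Product using (Σ; _×_; _,_; proj₁; proj₂)
open import Data.Sum using (_⊎_; inj₁; inj₂)
open import Data.Unit using (⊤; tt)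
open import Data.Empty using (⊥-elim)
open import Relation.Nullary using (yes; no; ¬_; Dec)
open import Relation.Binary.PropositionalEquality
open import Function using (_∘_)
open import Defs

tail₀ : List ℕ → List ℕ
tail₀ []      = []
tail₀ (_ ∷ w) = w

at-zero : ∀ w → at w 0 ≡ next w
at-zero []      = refl
at-zero (_ ∷ _) = refl

at-≥length : ∀ (xs : List ℕ) {j} → length xs ≤ j → at xs j ≡ 0
at-≥length []       _                = refl
at-≥length (_ ∷ xs) {suc j} (s≤s le) = at-≥length xs le

at-drop : ∀ n (xs : List ℕ) i → at (drop n xs) i ≡ at xs (n + i)
at-drop zero    xs       i = refl
at-drop (suc n) []       i = refl
at-drop (suc n) (x ∷ xs) i = at-drop n xs i

at-take : ∀ n (xs : List ℕ) i → i < n → at (take n xs) i ≡ at xs i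
at-take (suc n) []       i       _         = refl
at-take (suc n) (x ∷ xs) zero    _         = refl
at-take (suc n) (x ∷ xs) (suc i) (s≤s i<n) = at-take n xs i i<n

drop-length-++ : ∀ {A : Set} (xs ys : List A) → drop (length xs) (xs ++ ys) ≡ ys
drop-length-++ []       ys = refl
drop-length-++ (x ∷ xs) ys = drop-length-++ xs ys

take-length-++ : ∀ {A : Set} (xs ys : List A) → take (length xs) (xs ++ ys) ≡ xs
take-length-++ []       ys = refl
take-length-++ (x ∷ xs) ys = cong (x ∷_) (take-length-++ xs ys)

next≤head : ∀ {a} s → NonIncreasing (a ∷ s) → next s ≤ a
next≤head []      _         = z≤n
next≤head (_ ∷ _) (a≥b ∷ _) = a≥b

at≤next : ∀ {xs} → NonIncreasing xs → ∀ n → at xs n ≤ next xs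
at≤next {[]}         _         n       = z≤n
at≤next {_ ∷ []}     _         zero    = ≤-refl
at≤next {_ ∷ []}     _         (suc n) = z≤n
at≤next {_ ∷ _ ∷ _}  _         zero    = ≤-refl
at≤next {_ ∷ _ ∷ _}  (x≥y ∷ l) (suc n) = ≤-trans (at≤next l n) x≥y

Sorted : List ℕ → Set
Sorted = Linked _≤_

Sorted-lower : ∀ {x y zs} → x ≤ y → Sorted (y ∷ zs) → Sorted (x ∷ zs)
Sorted-lower x≤y [-]        = [-]
Sorted-lower x≤y (y≤z ∷ zs) = ≤-trans x≤y y≤z ∷ zs

0∷-sorted : ∀ {xs} → Sorted xs → Sorted (0 ∷ xs)
0∷-sorted []      = [-]
0∷-sorted [-]     = z≤n ∷ [-]
0∷-sorted (h ∷ l) = z≤n ∷ h ∷ l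

sorted⇒at : ∀ {xs} → Sorted xs → ∀ i → suc i < length xs → at xs i ≤ at xs (suc i)
sorted⇒at [-]       _       (s≤s ())
sorted⇒at (x≤y ∷ _) zero    _           = x≤y
sorted⇒at (_ ∷ l)   (suc i) (s≤s i+1<n) = sorted⇒at l i i+1<n

at⇒sorted : ∀ xs → (∀ i → suc i < length xs → at xs i ≤ at xs (suc i)) → Sorted xs
at⇒sorted []           _  = []
at⇒sorted (_ ∷ [])     _  = [-]
at⇒sorted (_ ∷ y ∷ xs) le = le 0 (s≤s (s≤s z≤n)) ∷ at⇒sorted (y ∷ xs) (λ i → le (suc i) ∘ s≤s)

All-reverse : ∀ {A : Set} {P : A → Set} {xs} → All P xs → All P (reverse xs)
All-reverse []                   = []
All-reverse {xs = x ∷ xs} (p ∷ ps) = subst (All _) (sym (unfold-reverse x xs)) (∷ʳ⁺ (All-reverse ps) p)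

≡+[n∸n] : ∀ x n → x ≡ x + (n ∸ n)
≡+[n∸n] x n = sym (trans (cong (x +_) (n∸n≡0 n)) (+-identityʳ x))

∸-split : ∀ {l b h} → l ≤ b → b ≤ h → (b ∸ l) + (h ∸ b) ≡ h ∸ l
∸-split {l} {b} {h} l≤b b≤h = begin
  (b ∸ l) + (h ∸ b)            ≡⟨ sym (m+n∸m≡n l _) ⟩
  l + ((b ∸ l) + (h ∸ b)) ∸ l  ≡⟨ cong (_∸ l) (sym (+-assoc l (b ∸ l) (h ∸ b))) ⟩
  l + (b ∸ l) + (h ∸ b) ∸ l    ≡⟨ cong (λ x → x + (h ∸ b) ∸ l) (m+[n∸m]≡n l≤b) ⟩
  b + (h ∸ b) ∸ l              ≡⟨ cong (_∸ l) (m+[n∸m]≡n b≤h) ⟩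
  h ∸ l                        ∎
  where open ≡-Reasoning

+∸-split : ∀ N {l b h} → l ≤ b → b ≤ h → N + (b ∸ l) + (h ∸ b) ≡ N + (h ∸ l)
+∸-split N l≤b b≤h = trans (+-assoc N _ _) (cong (N +_) (∸-split l≤b b≤h))

sumEvens : ℕ → ℕ
sumEvens zero    = 0
sumEvens (suc n) = sumEvens n + 2 * n

sumEvens-+ : ∀ a b → sumEvens (a + b) ≡ sumEvens a + sumEvens b + 2 * a * b
sumEvens-+ zero    b = sym (+-identityʳ (sumEvens b))
sumEvens-+ (suc a) b = trans (cong (_+ 2 * (a + b)) (sumEvens-+ a b)) (rearrange (sumEvens a) (sumEvens b) a b)
  where
    rearrange : ∀ ta tb a b → ta + tb + 2 * a * b + 2 * (a + b) ≡ ta + 2 * a + tb + 2 * suc a * b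
    rearrange = solve-∀

-- A word is a finitely supported sequence ℕ → ℕ, read off a list with
-- `at`; lists differing only by trailing zeros denote the same word.
infix 4 _≈_
record _≈_ (v w : List ℕ) : Set where
  constructor pointwise
  field at-≡ : ∀ u → at v u ≡ at w u
open _≈_ public

≈-refl : ∀ {w} → w ≈ w
≈-refl = pointwise λ _ → refl

≈-reflexive : ∀ {v w} → v ≡ w → v ≈ w
≈-reflexive refl = ≈-refl

≈-sym : ∀ {v w} → v ≈ w → w ≈ v
≈-sym v≈w = pointwise λ u → sym (at-≡ v≈w u)

≈-trans : ∀ {u v w} → u ≈ v → v ≈ w → u ≈ w
≈-trans u≈v v≈w = pointwise λ i → trans (at-≡ u≈v i) (at-≡ v≈w i)

∷-≈ : ∀ {x y v w} → x ≡ y → v ≈ w → x ∷ v ≈ y ∷ w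
∷-≈ x≡y v≈w = pointwise λ where
  zero    → x≡y
  (suc u) → at-≡ v≈w u

∷-≈-head : ∀ {x y v w} → x ∷ v ≈ y ∷ w → x ≡ y
∷-≈-head eq = at-≡ eq 0

∷-≈-tail : ∀ {x y v w} → x ∷ v ≈ y ∷ w → v ≈ w
∷-≈-tail eq = pointwise λ u → at-≡ eq (suc u)

next-≈ : ∀ {v w} → v ≈ w → next v ≡ next w
next-≈ {v} {w} v≈w = trans (sym (at-zero v)) (trans (at-≡ v≈w 0) (at-zero w))

tail₀-≈ : ∀ {v w} → v ≈ w → tail₀ v ≈ tail₀ w
tail₀-≈ {[]}    {[]}    _   = ≈-refl
tail₀-≈ {[]}    {_ ∷ _} eq  = pointwise λ u → at-≡ eq (suc u)
tail₀-≈ {_ ∷ _} {[]}    eq  = pointwise λ u → at-≡ eq (suc u)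
tail₀-≈ {_ ∷ _} {_ ∷ _} eq  = ∷-≈-tail eq

≈-next∷tail₀ : ∀ w → w ≈ next w ∷ tail₀ w
≈-next∷tail₀ []      = pointwise λ where
  zero    → refl
  (suc _) → refl
≈-next∷tail₀ (_ ∷ _) = ≈-refl

[]≈∷ : ∀ {x w} → [] ≈ x ∷ w → x ≡ 0 × [] ≈ w
[]≈∷ eq = sym (at-≡ eq 0) , pointwise λ u → at-≡ eq (suc u)

[]≈0∷ : ∀ {w} → [] ≈ w → [] ≈ 0 ∷ w
[]≈0∷ []≈w = pointwise λ where
  zero    → refl
  (suc u) → at-≡ []≈w u

-- Partitions from multiplicity words

wordWeight : List ℕ → ℕ
wordWeight []      = 0
wordWeight (_ ∷ w) = sum w + wordWeight w

partitionOf : List ℕ → List ℕ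
partitionOf []      = []
partitionOf (x ∷ w) = map suc (partitionOf w) ++ replicate x 0

multiplicities : List ℕ → List ℕ
multiplicities y = applyUpTo (λ u → mult u y) (suc (sum y))

mult-++ : ∀ u xs ys → mult u (xs ++ ys) ≡ mult u xs + mult u ys
mult-++ u xs ys = trans (cong length (filter-++ (_≟ u) xs ys)) (length-++ (filter (_≟ u) xs))

mult-here : ∀ u xs → mult u (u ∷ xs) ≡ suc (mult u xs)
mult-here u xs = cong length (filter-accept (_≟ u) refl)

mult-there : ∀ {u} x xs → x ≢ u → mult u (x ∷ xs) ≡ mult u xs
mult-there x xs x≢u = cong length (filter-reject (_≟ _) x≢u)

mult-zero-map-suc : ∀ xs → mult 0 (map suc xs) ≡ 0
mult-zero-map-suc []       = refl
mult-zero-map-suc (x ∷ xs) = trans (mult-there (suc x) (map suc xs) λ ()) (mult-zero-map-suc xs)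

mult-suc-map-suc : ∀ u xs → mult (suc u) (map suc xs) ≡ mult u xs
mult-suc-map-suc u []       = refl
mult-suc-map-suc u (x ∷ xs) with x ≟ u
... | yes refl = trans (mult-here (suc x) (map suc xs))
                       (trans (cong suc (mult-suc-map-suc x xs)) (sym (mult-here x xs)))
... | no x≢u   = trans (mult-there (suc x) (map suc xs) (x≢u ∘ suc-injective))
                       (trans (mult-suc-map-suc u xs) (sym (mult-there x xs x≢u)))

mult-zero-replicate : ∀ n → mult 0 (replicate n 0) ≡ n
mult-zero-replicate zero    = refl
mult-zero-replicate (suc n) = trans (mult-here 0 (replicate n 0)) (cong suc (mult-zero-replicate n))

mult-suc-replicate : ∀ u n → mult (suc u) (replicate n 0) ≡ 0
mult-suc-replicate u zero    = refl
mult-suc-replicate u (suc n) = trans (mult-there 0 (replicate n 0) λ ()) (mult-suc-replicate u n)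

mult-partitionOf : ∀ w u → mult u (partitionOf w) ≡ at w u
mult-partitionOf []      u       = refl
mult-partitionOf (x ∷ w) zero    = begin
  mult 0 (map suc (partitionOf w) ++ replicate x 0)           ≡⟨ mult-++ 0 (map suc (partitionOf w)) _ ⟩
  mult 0 (map suc (partitionOf w)) + mult 0 (replicate x 0)  ≡⟨ cong₂ _+_ (mult-zero-map-suc (partitionOf w)) (mult-zero-replicate x) ⟩
  x                                                           ∎
  where open ≡-Reasoning
mult-partitionOf (x ∷ w) (suc u) = begin
  mult (suc u) (map suc (partitionOf w) ++ replicate x 0)                  ≡⟨ mult-++ (suc u) (map suc (partitionOf w)) _ ⟩
  mult (suc u) (map suc (partitionOf w)) + mult (suc u) (replicate x 0)   ≡⟨ cong₂ _+_ (mult-suc-map-suc u (partitionOf w)) (mult-suc-replicate u x) ⟩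
  mult u (partitionOf w) + 0                                               ≡⟨ +-identityʳ _ ⟩
  mult u (partitionOf w)                                                   ≡⟨ mult-partitionOf w u ⟩
  at w u                                                                   ∎
  where open ≡-Reasoning

replicate-nonIncreasing : ∀ n x → NonIncreasing (replicate n x)
replicate-nonIncreasing zero          x = []
replicate-nonIncreasing (suc zero)    x = [-]
replicate-nonIncreasing (suc (suc n)) x = ≤-refl ∷ replicate-nonIncreasing (suc n) x

map-suc-++-zeros-nonIncreasing : ∀ {ys} n → NonIncreasing ys → NonIncreasing (map suc ys ++ replicate n 0)
map-suc-++-zeros-nonIncreasing {[]}         n       _         = replicate-nonIncreasing n 0
map-suc-++-zeros-nonIncreasing {_ ∷ []}     zero    _         = [-]
map-suc-++-zeros-nonIncreasing {_ ∷ []}     (suc n) _         = z≤n ∷ replicate-nonIncreasing (suc n) 0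
map-suc-++-zeros-nonIncreasing {_ ∷ _ ∷ _}  n       (y≥z ∷ l) = s≤s y≥z ∷ map-suc-++-zeros-nonIncreasing n l

partitionOf-nonIncreasing : ∀ w → NonIncreasing (partitionOf w)
partitionOf-nonIncreasing []      = []
partitionOf-nonIncreasing (x ∷ w) = map-suc-++-zeros-nonIncreasing x (partitionOf-nonIncreasing w)

mult-pos⇒≤head : ∀ u x xs → NonIncreasing (x ∷ xs) → 0 < mult u (x ∷ xs) → u ≤ x
mult-pos⇒≤head u x xs ni pos with x ≟ u
... | yes refl = ≤-refl
mult-pos⇒≤head u x []       ni        pos | no x≢u = ⊥-elim (<-irrefl (sym (mult-there x [] x≢u)) pos)
mult-pos⇒≤head u x (y ∷ xs) (x≥y ∷ l) pos | no x≢u =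
  ≤-trans (mult-pos⇒≤head u y xs l (≤-trans pos (≤-reflexive (mult-there x (y ∷ xs) x≢u)))) x≥y

nonIncreasing-mult-injective : ∀ xs ys → NonIncreasing xs → NonIncreasing ys →
                               (∀ u → mult u xs ≡ mult u ys) → xs ≡ ys
nonIncreasing-mult-injective []       []       _  _  _  = refl
nonIncreasing-mult-injective []       (y ∷ ys) _  _  eq = ⊥-elim (0≢1+n (trans (eq y) (mult-here y ys)))
nonIncreasing-mult-injective (x ∷ xs) []       _  _  eq = ⊥-elim (0≢1+n (trans (sym (eq x)) (mult-here x xs)))
nonIncreasing-mult-injective (x ∷ xs) (y ∷ ys) nx ny eq =
  cong₂ _∷_ x≡y (nonIncreasing-mult-injective xs ys (Linked.tail nx) (Linked.tail ny) tails)
  where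
    x≡y : x ≡ y
    x≡y = ≤-antisym (mult-pos⇒≤head x y ys ny (≤-trans (s≤s z≤n) (≤-reflexive (trans (sym (mult-here x xs)) (eq x)))))
                    (mult-pos⇒≤head y x xs nx (≤-trans (s≤s z≤n) (≤-reflexive (trans (sym (mult-here y ys)) (sym (eq y))))))
    tails : ∀ u → mult u xs ≡ mult u ys
    tails u with x ≟ u
    ... | yes refl = suc-injective (begin
      suc (mult x xs) ≡⟨ sym (mult-here x xs) ⟩
      mult x (x ∷ xs) ≡⟨ eq x ⟩
      mult x (y ∷ ys) ≡⟨ cong (λ z → mult x (z ∷ ys)) (sym x≡y) ⟩
      mult x (x ∷ ys) ≡⟨ mult-here x ys ⟩
      suc (mult x ys) ∎)
      where open ≡-Reasoning
    ... | no x≢u = trans (sym (mult-there x xs x≢u)) (trans (eq u) (mult-there y ys (x≢u ∘ trans x≡y)))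

partitionOf-≈ : ∀ {v w} → v ≈ w → partitionOf v ≡ partitionOf w
partitionOf-≈ {v} {w} v≈w =
  nonIncreasing-mult-injective _ _ (partitionOf-nonIncreasing v) (partitionOf-nonIncreasing w)
    λ u → trans (mult-partitionOf v u) (trans (at-≡ v≈w u) (sym (mult-partitionOf w u)))

at-applyUpTo : ∀ f n u → u < n → at (applyUpTo f n) u ≡ f u
at-applyUpTo f (suc n) zero    _         = refl
at-applyUpTo f (suc n) (suc u) (s≤s u<n) = at-applyUpTo (f ∘ suc) n u u<n

at-applyUpTo-≥ : ∀ f n u → n ≤ u → at (applyUpTo f n) u ≡ 0
at-applyUpTo-≥ f zero    u       _         = refl
at-applyUpTo-≥ f (suc n) (suc u) (s≤s n≤u) = at-applyUpTo-≥ (f ∘ suc) n u n≤u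

sum<⇒mult≡0 : ∀ u y → sum y < u → mult u y ≡ 0
sum<⇒mult≡0 u []      _   = refl
sum<⇒mult≡0 u (x ∷ y) lt =
  trans (mult-there x y λ x≡u → <-irrefl x≡u (≤-trans (s≤s (m≤m+n x (sum y))) lt))
        (sum<⇒mult≡0 u y (≤-trans (s≤s (m≤n+m (sum y) x)) lt))

at-multiplicities : ∀ y u → at (multiplicities y) u ≡ mult u y
at-multiplicities y u with u <? suc (sum y)
... | yes u<n = at-applyUpTo (λ v → mult v y) (suc (sum y)) u u<n
... | no  u≮n = trans (at-applyUpTo-≥ (λ v → mult v y) (suc (sum y)) u (≮⇒≥ u≮n))
                      (sym (sum<⇒mult≡0 u y (≮⇒≥ u≮n)))

partitionOf-multiplicities : ∀ y → NonIncreasing y → partitionOf (multiplicities y) ≡ y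
partitionOf-multiplicities y ni =
  nonIncreasing-mult-injective _ _ (partitionOf-nonIncreasing (multiplicities y)) ni
    λ u → trans (mult-partitionOf (multiplicities y) u) (at-multiplicities y u)

multiplicities-partitionOf : ∀ w → multiplicities (partitionOf w) ≈ w
multiplicities-partitionOf w = pointwise λ u → trans (at-multiplicities (partitionOf w) u) (mult-partitionOf w u)

sum-map-suc : ∀ xs → sum (map suc xs) ≡ sum xs + length xs
sum-map-suc []       = refl
sum-map-suc (x ∷ xs) = trans (cong (suc x +_) (sum-map-suc xs)) (rearrange x (sum xs) (length xs))
  where
    rearrange : ∀ x s l → suc x + (s + l) ≡ x + s + suc l
    rearrange = solve-∀

sum-replicate-zero : ∀ n → sum (replicate n 0) ≡ 0
sum-replicate-zero zero    = refl
sum-replicate-zero (suc n) = sum-replicate-zero n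

length-partitionOf : ∀ w → length (partitionOf w) ≡ sum w
length-partitionOf []      = refl
length-partitionOf (x ∷ w) = begin
  length (map suc (partitionOf w) ++ replicate x 0)        ≡⟨ length-++ (map suc (partitionOf w)) ⟩
  length (map suc (partitionOf w)) + length (replicate x 0) ≡⟨ cong₂ _+_ (length-map suc (partitionOf w)) (length-replicate x) ⟩
  length (partitionOf w) + x                                ≡⟨ cong (_+ x) (length-partitionOf w) ⟩
  sum w + x                                                 ≡⟨ +-comm (sum w) x ⟩
  x + sum w                                                 ∎
  where open ≡-Reasoning

weight-partitionOf : ∀ w → weight (partitionOf w) ≡ wordWeight w
weight-partitionOf []      = refl
weight-partitionOf (x ∷ w) = begin
  sum (map suc (partitionOf w) ++ replicate x 0)          ≡⟨ sum-++ (map suc (partitionOf w)) _ ⟩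
  sum (map suc (partitionOf w)) + sum (replicate x 0)     ≡⟨ cong₂ _+_ (sum-map-suc (partitionOf w)) (sum-replicate-zero x) ⟩
  weight (partitionOf w) + length (partitionOf w) + 0     ≡⟨ cong₂ (λ a b → a + b + 0) (weight-partitionOf w) (length-partitionOf w) ⟩
  wordWeight w + sum w + 0                                ≡⟨ trans (+-identityʳ _) (+-comm (wordWeight w) (sum w)) ⟩
  sum w + wordWeight w                                    ∎
  where open ≡-Reasoning

sum-≈ : ∀ {v w} → v ≈ w → sum v ≡ sum w
sum-≈ {v} {w} v≈w = begin
  sum v                    ≡⟨ length-partitionOf v ⟨
  length (partitionOf v)   ≡⟨ cong length (partitionOf-≈ v≈w) ⟩
  length (partitionOf w)   ≡⟨ length-partitionOf w ⟩
  sum w                    ∎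
  where open ≡-Reasoning

wordWeight-≈ : ∀ {v w} → v ≈ w → wordWeight v ≡ wordWeight w
wordWeight-≈ {v} {w} v≈w = begin
  wordWeight v             ≡⟨ weight-partitionOf v ⟨
  weight (partitionOf v)   ≡⟨ cong weight (partitionOf-≈ v≈w) ⟩
  weight (partitionOf w)   ≡⟨ weight-partitionOf w ⟩
  wordWeight w             ∎
  where open ≡-Reasoning

-- Admissible words

Admissible : ℕ → List ℕ → Set
Admissible K []      = ⊤
Admissible K (x ∷ w) = x + next w ≤ K × Admissible K w

next≤ : ∀ {K} w → Admissible K w → next w ≤ K
next≤ []      _               = z≤n
next≤ (x ∷ w) (x+next≤K , _) = ≤-trans (m≤m+n x (next w)) x+next≤K

admissible-tail₀ : ∀ {K} w → Admissible K w → Admissible K (tail₀ w)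
admissible-tail₀ []      _         = tt
admissible-tail₀ (_ ∷ _) (_ , adm) = adm

admissible-next : ∀ {K} w → Admissible K w → next w + next (tail₀ w) ≤ K
admissible-next []      _         = z≤n
admissible-next (_ ∷ _) (le , _)  = le

admissible⇒at : ∀ {K} w → Admissible K w → ∀ u → at w u + at w (suc u) ≤ K
admissible⇒at []      _              u       = z≤n
admissible⇒at (x ∷ w) (x+next≤K , _) zero    = subst (λ n → x + n ≤ _) (sym (at-zero w)) x+next≤K
admissible⇒at (x ∷ w) (_ , adm)       (suc u) = admissible⇒at w adm u

at⇒admissible : ∀ {K} w → (∀ u → at w u + at w (suc u) ≤ K) → Admissible K w
at⇒admissible []      _     = tt
at⇒admissible (x ∷ w) bound =
  subst (λ n → x + n ≤ _) (at-zero w) (bound 0) , at⇒admissible w (bound ∘ suc)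

admissible-zero : ∀ w → Admissible 0 w → [] ≈ w
admissible-zero []      _              = ≈-refl
admissible-zero (x ∷ w) (x+next≤0 , adm)
  with refl ← n≤0⇒n≡0 (m+n≤o⇒m≤o x x+next≤0) = []≈0∷ (admissible-zero w adm)

-- Inserting clusters

module Insertion (k : ℕ) where

  K : ℕ
  K = suc k

  -- In a K-word, `cluster b` stands for two adjacent entries (K ∸ b , b)
  -- with b ≤ k; every other entry is a `letter`.
  data Piece : Set where
    letter  : ℕ → Piece
    cluster : ℕ → Piece

  letters : List Piece → List ℕ
  letters []               = []
  letters (letter d ∷ s)   = d ∷ letters s
  letters (cluster _ ∷ s)  = letters s

  clusters : List Piece → ℕ
  clusters []               = 0
  clusters (letter _ ∷ s)   = clusters s
  clusters (cluster _ ∷ s)  = suc (clusters s)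

  flatten : List Piece → List ℕ
  flatten []               = []
  flatten (letter d ∷ s)   = d ∷ flatten s
  flatten (cluster b ∷ s)  = suc (k ∸ b) ∷ b ∷ flatten s

  -- A final entry K is read as the cluster (K , 0), borrowing a trailing 0.
  parse : List ℕ → List Piece
  parseAt : (x : ℕ) (w : List ℕ) → Dec (x + next w ≡ k) → List Piece
  parse []          = []
  parse (zero ∷ w)  = letter zero ∷ parse w
  parse (suc x ∷ w) = parseAt x w (x + next w ≟ k)
  parseAt x w       (no _)  = letter (suc x) ∷ parse w
  parseAt x []      (yes _) = cluster 0 ∷ []
  parseAt x (y ∷ w) (yes _) = cluster y ∷ parse w

  -- A cluster b fits between the letters p and d iff lo p ≤ b ≤ hi d:
  -- then p + (K ∸ b) ≤ K without p starting a cluster, and b + d ≤ K.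
  lo : ℕ → ℕ
  lo zero    = zero
  lo (suc p) = suc (suc p)

  hi : ℕ → ℕ
  hi zero    = k
  hi (suc d) = k ∸ d

  -- `Valid p m s`: s can follow a prefix whose last letter is p and whose
  -- clusters after p are ≤ m; the letters then form a k-word and the
  -- clusters between two letters increase weakly.
  Valid : ℕ → ℕ → List Piece → Set
  Valid p m []               = m ≤ k
  Valid p m (letter d ∷ s)   = p + d ≤ k × m ≤ hi d × Valid d 0 s
  Valid p m (cluster b ∷ s)  = lo p ≤ b × m ≤ b × Valid p b s

  hi≤k : ∀ d → hi d ≤ k
  hi≤k zero    = ≤-refl
  hi≤k (suc d) = m∸n≤m k d

  ≤hi⇒+≤K : ∀ {m} d → d ≤ k → m ≤ hi d → m + d ≤ K
  ≤hi⇒+≤K {m} zero    _   m≤k = subst (_≤ K) (sym (+-identityʳ m)) (m≤n⇒m≤1+n m≤k)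
  ≤hi⇒+≤K {m} (suc d) d<k m≤k∸d = begin
    m + suc d        ≡⟨ +-suc m d ⟩
    suc (m + d)      ≤⟨ s≤s (+-monoˡ-≤ d m≤k∸d) ⟩
    suc (k ∸ d + d)  ≡⟨ cong suc (m∸n+n≡m (<⇒≤ d<k)) ⟩
    K                ∎
    where open ≤-Reasoning

  p≤lo : ∀ p → p ≤ lo p
  p≤lo zero    = z≤n
  p≤lo (suc p) = n≤1+n (suc p)

  Valid⇒≤hi : ∀ p m s → Valid p m s → m ≤ hi (next (letters s))
  Valid⇒≤hi p m []              m≤k             = m≤k
  Valid⇒≤hi p m (letter d ∷ s)  (_ , m≤hi , _)  = m≤hi
  Valid⇒≤hi p m (cluster b ∷ s) (_ , m≤b , v)   = ≤-trans m≤b (Valid⇒≤hi p b s v)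

  Valid⇒≤k : ∀ p m s → Valid p m s → m ≤ k
  Valid⇒≤k p m s v = ≤-trans (Valid⇒≤hi p m s v) (hi≤k (next (letters s)))

  Valid-lower : ∀ {p m m′} s → m′ ≤ m → Valid p m s → Valid p m′ s
  Valid-lower []              m′≤m m≤k             = ≤-trans m′≤m m≤k
  Valid-lower (letter d ∷ s)  m′≤m (pd , m≤hi , v) = pd , ≤-trans m′≤m m≤hi , v
  Valid-lower (cluster b ∷ s) m′≤m (lb , m≤b , v)  = lb , ≤-trans m′≤m m≤b , v

  flatten-parse : ∀ w → flatten (parse w) ≈ w
  flatten-parse []          = ≈-refl
  flatten-parse (zero ∷ w)  = ∷-≈ refl (flatten-parse w)
  flatten-parse (suc x ∷ w) with x + next w ≟ k
  ... | no _ = ∷-≈ refl (flatten-parse w)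
  flatten-parse (suc x ∷ [])    | yes x+0≡k =
    ∷-≈ (cong suc (sym (trans (sym (+-identityʳ x)) x+0≡k))) (≈-sym ([]≈0∷ ≈-refl))
  flatten-parse (suc x ∷ y ∷ w) | yes x+y≡k =
    ∷-≈ (cong suc (trans (cong (_∸ y) (sym x+y≡k)) (m+n∸n≡m x y))) (∷-≈ refl (flatten-parse w))

  -- After a letter d + 1 comes a letter e with d + 1 + e ≤ k, or a
  -- cluster b > d + 1; either way d + next ≢ k.
  letter-starts-no-cluster : ∀ d s → Valid (suc d) 0 s → suc d ≤ k → d + next (flatten s) ≢ k
  letter-starts-no-cluster d []               _            d<k eq = <-irrefl eq (subst (_≤ k) (cong suc (sym (+-identityʳ d))) d<k)
  letter-starts-no-cluster d (letter e ∷ s)   (de≤k , _)   _   eq = <-irrefl eq de≤k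
  letter-starts-no-cluster d (cluster b ∷ s)  (d<b , _ , v) _  eq = <-irrefl refl (≤-trans d<b (≤-reflexive (sym d+1≡b)))
    where
      b≤k : b ≤ k
      b≤k = Valid⇒≤k (suc d) b s v
      d+1≡b : suc d ≡ b
      d+1≡b = +-cancelʳ-≡ (k ∸ b) (suc d) b (begin
        suc d + (k ∸ b)  ≡⟨ sym (+-suc d (k ∸ b)) ⟩
        d + suc (k ∸ b)  ≡⟨ eq ⟩
        k                ≡⟨ sym (m+[n∸m]≡n b≤k) ⟩
        b + (k ∸ b)      ∎)
        where open ≡-Reasoning

  parse-flatten : ∀ p m s → Valid p m s → parse (flatten s) ≡ s
  parse-flatten p m []                    _           = refl
  parse-flatten p m (letter zero ∷ s)     (_ , _ , v) = cong (letter zero ∷_) (parse-flatten zero 0 s v)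
  parse-flatten p m (letter (suc d) ∷ s)  (pd , _ , v) with d + next (flatten s) ≟ k
  ... | yes eq = ⊥-elim (letter-starts-no-cluster d s v (≤-trans (m≤n+m (suc d) p) pd) eq)
  ... | no _   = cong (letter (suc d) ∷_) (parse-flatten (suc d) 0 s v)
  parse-flatten p m (cluster b ∷ s)       (_ , _ , v) with (k ∸ b) + b ≟ k
  ... | yes _ = cong (cluster b ∷_) (parse-flatten p b s v)
  ... | no ne = ⊥-elim (ne (m∸n+n≡m (Valid⇒≤k p b s v)))

  +suc[k∸b]≤K : ∀ {d b} → d ≤ b → b ≤ k → d + suc (k ∸ b) ≤ K
  +suc[k∸b]≤K {d} {b} d≤b b≤k = begin
    d + suc (k ∸ b)    ≡⟨ +-suc d (k ∸ b) ⟩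
    suc (d + (k ∸ b))  ≤⟨ s≤s (+-monoˡ-≤ (k ∸ b) d≤b) ⟩
    suc (b + (k ∸ b))  ≡⟨ cong suc (m+[n∸m]≡n b≤k) ⟩
    K                  ∎
    where open ≤-Reasoning

  letter-then-flatten≤K : ∀ d s → Valid d 0 s → d ≤ k → d + next (flatten s) ≤ K
  letter-then-flatten≤K d []              _             d≤k = subst (_≤ K) (sym (+-identityʳ d)) (m≤n⇒m≤1+n d≤k)
  letter-then-flatten≤K d (letter e ∷ s)  (de≤k , _)    _   = m≤n⇒m≤1+n de≤k
  letter-then-flatten≤K d (cluster b ∷ s) (lb , _ , v)  _   = +suc[k∸b]≤K (≤-trans (p≤lo d) lb) (Valid⇒≤k d b s v)

  cluster-then-flatten≤K : ∀ p m s → Valid p m s → m + next (flatten s) ≤ K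
  cluster-then-flatten≤K p m []              m≤k               = subst (_≤ K) (sym (+-identityʳ m)) (m≤n⇒m≤1+n m≤k)
  cluster-then-flatten≤K p m (letter e ∷ s)  (pe≤k , m≤hi , _) = ≤hi⇒+≤K e (≤-trans (m≤n+m e p) pe≤k) m≤hi
  cluster-then-flatten≤K p m (cluster b ∷ s) (_ , m≤b , v)     = +suc[k∸b]≤K m≤b (Valid⇒≤k p b s v)

  flatten-admissible : ∀ p m s → Valid p m s → Admissible K (flatten s)
  flatten-admissible p m []              _             = tt
  flatten-admissible p m (letter d ∷ s)  (pd≤k , _ , v) =
    letter-then-flatten≤K d s v (≤-trans (m≤n+m d p) pd≤k) , flatten-admissible d 0 s v
  flatten-admissible p m (cluster b ∷ s) (_ , _ , v)   =
    ≤-reflexive (cong suc (m∸n+n≡m (Valid⇒≤k p b s v))) , cluster-then-flatten≤K p b s v , flatten-admissible p b s v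

  <⇒lo≤ : ∀ p {y} → p < y → lo p ≤ y
  <⇒lo≤ zero    _   = z≤n
  <⇒lo≤ (suc p) p<y = p<y

  module _ {x y : ℕ} (x+y≡k : x + y ≡ k) where

    +suc≤K⇒≤ : ∀ {m} → m + suc x ≤ K → m ≤ y
    +suc≤K⇒≤ {m} m+x<K = +-cancelʳ-≤ (suc x) m y (begin
      m + suc x  ≤⟨ m+x<K ⟩
      suc k      ≡⟨ cong suc (trans (sym x+y≡k) (+-comm x y)) ⟩
      suc (y + x) ≡⟨ sym (+-suc y x) ⟩
      y + suc x  ∎)
      where open ≤-Reasoning

    +suc≤k⇒< : ∀ {p} → p + suc x ≤ k → p < y
    +suc≤k⇒< {p} p+x<k = +-cancelʳ-≤ x (suc p) y (begin
      suc p + x  ≡⟨ sym (+-suc p x) ⟩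
      p + suc x  ≤⟨ p+x<k ⟩
      k          ≡⟨ trans (sym x+y≡k) (+-comm x y) ⟩
      y + x      ∎)
      where open ≤-Reasoning

    lo≤ : ∀ {p} → p ≡ 0 ⊎ p + suc x ≤ k → lo p ≤ y
    lo≤ (inj₁ refl)  = z≤n
    lo≤ (inj₂ p+x<k) = <⇒lo≤ _ (+suc≤k⇒< p+x<k)

  -- The last hypothesis says that the letter p did not start a cluster.
  parse-valid : ∀ w p m → Admissible K w → m + next w ≤ K → m ≤ k →
                p ≡ 0 ⊎ p + next w ≤ k → Valid p m (parse w)
  parse-valid []          p m _         _     m≤k _ = m≤k
  parse-valid (zero ∷ w)  p m (_ , adm) _     m≤k p-0 =
    p+0≤k p-0 , m≤k , parse-valid w zero 0 adm (next≤ w adm) z≤n (inj₁ refl)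
    where
      p+0≤k : p ≡ 0 ⊎ p + 0 ≤ k → p + 0 ≤ k
      p+0≤k (inj₁ refl) = z≤n
      p+0≤k (inj₂ le)   = le
  parse-valid (suc x ∷ w) p m adm m+x<K m≤k p-x with x + next w ≟ k
  parse-valid (suc x ∷ [])    p m _ m+x<K _ p-x | yes x+0≡k =
    lo≤ x+0≡k p-x , +suc≤K⇒≤ x+0≡k m+x<K , z≤n
  parse-valid (suc x ∷ y ∷ w) p m (_ , y+next≤K , adm) m+x<K _ p-x | yes x+y≡k =
    lo≤ x+y≡k p-x , +suc≤K⇒≤ x+y≡k m+x<K ,
    parse-valid w p y adm y+next≤K (subst (y ≤_) x+y≡k (m≤n+m y x)) (p+next≤k p-x)
    where
      p+next≤k : p ≡ 0 ⊎ p + suc x ≤ k → p ≡ 0 ⊎ p + next w ≤ k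
      p+next≤k (inj₁ p≡0)  = inj₁ p≡0
      p+next≤k (inj₂ p+x<k) = inj₂ (≤-pred (≤-trans (+-monoˡ-≤ (next w) (+suc≤k⇒< x+y≡k p+x<k)) y+next≤K))
  parse-valid (suc x ∷ w) p m (x+next≤K , adm) m+x<K _ p-x | no x+next≢k =
    p+x<k p-x , m≤k∸x , parse-valid w (suc x) 0 adm (next≤ w adm) z≤n (inj₂ x+next<k)
    where
      x+next<k : suc x + next w ≤ k
      x+next<k = ≤∧≢⇒< (≤-pred x+next≤K) x+next≢k
      p+x<k : p ≡ 0 ⊎ p + suc x ≤ k → p + suc x ≤ k
      p+x<k (inj₁ refl) = ≤-trans (m≤m+n (suc x) (next w)) x+next<k
      p+x<k (inj₂ le)   = le
      m≤k∸x : m ≤ k ∸ x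
      m≤k∸x = m+n≤o⇒m≤o∸n m (≤-pred (subst (_≤ K) (+-suc m x) m+x<K))

  gapSize : ℕ → ℕ → ℕ
  gapSize p d = suc (hi d) ∸ lo p

  gapSize-empty : ∀ d e → ¬ (lo d ≤ hi e) → gapSize d e ≡ 0
  gapSize-empty _ _ lo≰hi = m≤n⇒m∸n≡0 (≰⇒> lo≰hi)

  -- The admissible cluster values of all gaps, laid end to end, are
  -- numbered 0, 1, 2, …; N is the number of positions in earlier gaps.
  positions : ℕ → ℕ → List Piece → List ℕ
  positions p N []              = []
  positions p N (letter d ∷ s)  = positions d (N + gapSize p d) s
  positions p N (cluster b ∷ s) = N + (b ∸ lo p) ∷ positions p N s

  -- The inverse of (positions , letters): standing at position V, which
  -- is value b of the gap after letter p, advance to the next position in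
  -- vs and put a cluster there.  Past the end of w the letters read as 0.
  -- A gap is empty only between the letters k and 0 (see gap-empty⇒0),
  -- so then both letters are passed at once.
  walk : ℕ → ℕ → ℕ → ℕ → List ℕ → List ℕ → List Piece
  walkStep : ℕ → ℕ → (b : ℕ) → ℕ → List ℕ → (w : List ℕ) →
             Dec (b < hi (next w)) → Dec (lo (next w) ≤ hi (next (tail₀ w))) → List Piece
  place : ℕ → ℕ → ℕ → List ℕ → List ℕ → List Piece
  walk zero    p b V vs w = cluster b ∷ place p b V vs w
  walk (suc c) p b V vs w = walkStep c p b V vs w (b <? hi (next w)) (lo (next w) ≤? hi (next (tail₀ w)))
  walkStep c p b V vs w (yes _) _       = walk c p (suc b) (suc V) vs w
  walkStep c p b V vs w (no _)  (yes _) =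
    letter (next w) ∷ walk c (next w) (lo (next w)) (suc V) vs (tail₀ w)
  walkStep c p b V vs w (no _)  (no _)  =
    letter (next w) ∷ letter (next (tail₀ w)) ∷
    walk c (next (tail₀ w)) (lo (next (tail₀ w))) (suc V) vs (tail₀ (tail₀ w))
  place p b V []       w = map letter w
  place p b V (v ∷ vs) w = walk (v ∸ V) p b V vs w

  positions-sorted : ∀ p m N s → Valid p m s → Sorted (N + (m ∸ lo p) ∷ positions p N s)
  positions-sorted p m N []              _              = [-]
  positions-sorted p m N (letter d ∷ s)  (_ , m≤hi , v) =
    Sorted-lower (begin
      N + (m ∸ lo p)                ≤⟨ +-monoʳ-≤ N (∸-monoˡ-≤ (lo p) (m≤n⇒m≤1+n m≤hi)) ⟩
      N + gapSize p d               ≡⟨ sym (+-identityʳ _) ⟩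
      N + gapSize p d + 0           ≡⟨ cong (N + gapSize p d +_) (sym (0∸n≡0 (lo d))) ⟩
      N + gapSize p d + (0 ∸ lo d)  ∎) (positions-sorted d 0 (N + gapSize p d) s v)
    where open ≤-Reasoning
  positions-sorted p m N (cluster b ∷ s) (_ , m≤b , v)  =
    +-monoʳ-≤ N (∸-monoˡ-≤ (lo p) m≤b) ∷ positions-sorted p b N s v

  letters-admissible : ∀ p m s → Valid p m s → p ≤ k → Admissible k (letters s) × p + next (letters s) ≤ k
  letters-admissible p m []              _            p≤k = tt , subst (_≤ k) (sym (+-identityʳ p)) p≤k
  letters-admissible p m (letter d ∷ s)  (pd≤k , _ , v) _ =
    let adm , d+next≤k = letters-admissible d 0 s v (m+n≤o⇒n≤o p pd≤k) in (d+next≤k , adm) , pd≤k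
  letters-admissible p m (cluster b ∷ s) (_ , _ , v)  p≤k = letters-admissible p b s v p≤k

  walk-in-gap : ∀ c c′ p b V vs w → b + c ≤ hi (next w) →
                walk (c + c′) p b V vs w ≡ walk c′ p (b + c) (V + c) vs w
  walk-in-gap zero    c′ p b V vs w _ =
    cong₂ (λ b′ V′ → walk c′ p b′ V′ vs w) (sym (+-identityʳ b)) (sym (+-identityʳ V))
  walk-in-gap (suc c) c′ p b V vs w b+c<hi with b <? hi (next w)
  ... | yes _   = trans (walk-in-gap c c′ p (suc b) (suc V) vs w (subst (_≤ hi (next w)) (+-suc b c) b+c<hi))
                        (cong₂ (λ b′ V′ → walk c′ p b′ V′ vs w) (sym (+-suc b c)) (sym (+-suc V c)))
  ... | no b≮hi = ⊥-elim (b≮hi (≤-trans (s≤s (m≤m+n b c)) (subst (_≤ hi (next w)) (+-suc b c) b+c<hi)))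

  positions≡[]⇒letters : ∀ p N s → positions p N s ≡ [] → map letter (letters s) ≡ s
  positions≡[]⇒letters p N []              _  = refl
  positions≡[]⇒letters p N (letter d ∷ s)  eq = cong (letter d ∷_) (positions≡[]⇒letters d (N + gapSize p d) s eq)

  Valid-raise : ∀ d s → Valid d 0 s → lo d ≤ hi (next (letters s)) → Valid d (lo d) s
  Valid-raise d []              _              lo≤hi = lo≤hi
  Valid-raise d (letter e ∷ s)  (de≤k , _ , v) lo≤hi = de≤k , lo≤hi , v
  Valid-raise d (cluster b ∷ s) (lo≤b , _ , v) _     = lo≤b , lo≤b , v

  gap-empty⇒0 : ∀ d e → d + e ≤ k → ¬ (lo d ≤ hi e) → e ≡ 0
  gap-empty⇒0 d zero    _      _      = refl
  gap-empty⇒0 d (suc e) de≤k lo≰hi = ⊥-elim (lo≰hi (≤-trans (lo≤suc d) (m+n≤o⇒m≤o∸n (suc d) (subst (_≤ k) (+-suc d e) de≤k))))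
    where
      lo≤suc : ∀ d → lo d ≤ suc d
      lo≤suc zero    = z≤n
      lo≤suc (suc d) = ≤-refl

  suc-V≡gapEnd : ∀ {p b N V} d → V ≡ N + (b ∸ lo p) → lo p ≤ b → b ≡ hi d → suc V ≡ N + gapSize p d
  suc-V≡gapEnd {p} {b} {N} {V} d V≡ lo≤b refl = begin
    suc V                  ≡⟨ cong suc V≡ ⟩
    suc (N + (b ∸ lo p))   ≡⟨ +-suc N _ ⟨
    N + suc (b ∸ lo p)     ≡⟨ cong (N +_) (+-∸-assoc 1 lo≤b) ⟨
    N + gapSize p d        ∎
    where open ≡-Reasoning

  place-∷ : ∀ p b V t vs w → place p b V (V + t ∷ vs) w ≡ walk t p b V vs w
  place-∷ p b V t vs w = cong (λ c → walk c p b V vs w) (m+n∸m≡n V t)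

  place-positions : ∀ s p b N → Valid p b s → lo p ≤ b →
                    place p b (N + (b ∸ lo p)) (positions p N s) (letters s) ≡ s
  walk-past-letter : ∀ p d s t V vs → Valid d 0 s → positions d (suc V) s ≡ suc V + t ∷ vs →
                     walk (suc t) p (hi d) V vs (d ∷ letters s) ≡ letter d ∷ s
  place-gap-start : ∀ d N s → Valid d (lo d) s → place d (lo d) N (positions d N s) (letters s) ≡ s

  place-positions [] p b N _ _ = refl
  place-positions (cluster b′ ∷ s) p b N (lo≤b′ , b≤b′ , v) lo≤b = begin
    place p b V (N + (b′ ∸ lo p) ∷ Ps) L                 ≡⟨ cong (λ x → place p b V (x ∷ Ps) L) V+c≡ ⟨
    place p b V (V + c ∷ Ps) L                           ≡⟨ place-∷ p b V c Ps L ⟩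
    walk c p b V Ps L                                    ≡⟨ cong (λ x → walk x p b V Ps L) (+-identityʳ c) ⟨
    walk (c + 0) p b V Ps L                              ≡⟨ walk-in-gap c 0 p b V Ps L b+c≤hi ⟩
    walk 0 p (b + c) (V + c) Ps L                        ≡⟨ cong₂ (λ b″ V′ → walk 0 p b″ V′ Ps L) (m+[n∸m]≡n b≤b′) V+c≡ ⟩
    cluster b′ ∷ place p b′ (N + (b′ ∸ lo p)) Ps L       ≡⟨ cong (cluster b′ ∷_) (place-positions s p b′ N v lo≤b′) ⟩
    cluster b′ ∷ s                                      ∎
    where
      open ≡-Reasoning
      V = N + (b ∸ lo p)
      c = b′ ∸ b
      Ps = positions p N s
      L = letters s
      V+c≡ : V + c ≡ N + (b′ ∸ lo p)
      V+c≡ = +∸-split N lo≤b b≤b′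
      b+c≤hi : b + c ≤ hi (next L)
      b+c≤hi = subst (_≤ _) (sym (m+[n∸m]≡n b≤b′)) (Valid⇒≤hi p b′ s v)
  place-positions (letter d ∷ s) p b N (pd≤k , b≤hi , v) lo≤b with positions d (N + gapSize p d) s in eq
  ... | []      = cong (letter d ∷_) (positions≡[]⇒letters d (N + gapSize p d) s eq)
  ... | v₁ ∷ vs = begin
    place p b V (v₁ ∷ vs) (d ∷ letters s)            ≡⟨ cong (λ x → place p b V (x ∷ vs) (d ∷ letters s)) v₁≡ ⟩
    place p b V (V + (c + suc t) ∷ vs) (d ∷ letters s) ≡⟨ place-∷ p b V (c + suc t) vs (d ∷ letters s) ⟩
    walk (c + suc t) p b V vs (d ∷ letters s)        ≡⟨ walk-in-gap c (suc t) p b V vs (d ∷ letters s) (≤-reflexive (m+[n∸m]≡n b≤hi)) ⟩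
    walk (suc t) p (b + c) V′ vs (d ∷ letters s)     ≡⟨ cong (λ b′ → walk (suc t) p b′ V′ vs (d ∷ letters s)) (m+[n∸m]≡n b≤hi) ⟩
    walk (suc t) p (hi d) V′ vs (d ∷ letters s)      ≡⟨ walk-past-letter p d s t V′ vs v eq′ ⟩
    letter d ∷ s                                     ∎
    where
      open ≡-Reasoning
      V  = N + (b ∸ lo p)
      c  = hi d ∸ b
      V′ = V + c
      suc-V′ : suc V′ ≡ N + gapSize p d
      suc-V′ = suc-V≡gapEnd d (+∸-split N lo≤b b≤hi) (≤-trans lo≤b b≤hi) refl
      V′<v₁ : suc V′ ≤ v₁
      V′<v₁ = ≤-trans (≤-reflexive (sym (begin
        N + gapSize p d + (0 ∸ lo d)  ≡⟨ cong (N + gapSize p d +_) (0∸n≡0 (lo d)) ⟩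
        N + gapSize p d + 0           ≡⟨ +-identityʳ _ ⟩
        N + gapSize p d               ≡⟨ suc-V′ ⟨
        suc V′                        ∎)))
        (Linked.head (subst (λ xs → Sorted (_ ∷ xs)) eq (positions-sorted d 0 (N + gapSize p d) s v)))
      t = v₁ ∸ suc V′
      v₁≡ : v₁ ≡ V + (c + suc t)
      v₁≡ = begin
        v₁               ≡⟨ m+[n∸m]≡n V′<v₁ ⟨
        suc V′ + t       ≡⟨ +-suc V′ t ⟨
        V′ + suc t       ≡⟨ +-assoc V c (suc t) ⟩
        V + (c + suc t)  ∎
      eq′ : positions d (suc V′) s ≡ suc V′ + t ∷ vs
      eq′ = trans (cong (λ M → positions d M s) suc-V′) (trans eq (cong (_∷ vs) (sym (m+[n∸m]≡n V′<v₁))))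

  place-gap-start d N s v =
    subst (λ V → place d (lo d) V (positions d N s) (letters s) ≡ s) (sym (≡+[n∸n] N (lo d)))
          (place-positions s d (lo d) N v ≤-refl)

  walk-past-letter p d s t V vs v eq with hi d <? hi d | lo d ≤? hi (next (letters s))
  ... | yes hi<hi | _ = ⊥-elim (<-irrefl refl hi<hi)
  ... | no _ | yes lo≤hi = cong (letter d ∷_) (begin
    walk t d (lo d) (suc V) vs (letters s)                      ≡⟨ place-∷ d (lo d) (suc V) t vs (letters s) ⟨
    place d (lo d) (suc V) (suc V + t ∷ vs) (letters s)         ≡⟨ cong (λ xs → place d (lo d) (suc V) xs (letters s)) eq ⟨
    place d (lo d) (suc V) (positions d (suc V) s) (letters s)  ≡⟨ place-gap-start d (suc V) s (Valid-raise d s v lo≤hi) ⟩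
    s                                                           ∎)
    where open ≡-Reasoning
  walk-past-letter p d []                t V vs _ () | no _ | no _
  walk-past-letter p d (cluster b ∷ s) t V vs (lo≤b , _ , v) _ | no _ | no lo≰hi =
    ⊥-elim (lo≰hi (≤-trans lo≤b (Valid⇒≤hi d b s v)))
  walk-past-letter p d (letter e ∷ s) t V vs (de≤k , _ , v) eq | no _ | no lo≰hi =
    cong (λ s′ → letter d ∷ letter e ∷ s′) (begin
      walk t e (lo e) (suc V) vs (letters s)                       ≡⟨ place-∷ e (lo e) (suc V) t vs (letters s) ⟨
      place e (lo e) (suc V) (suc V + t ∷ vs) (letters s)          ≡⟨ cong (λ xs → place e (lo e) (suc V) xs (letters s)) eq′ ⟨
      place e (lo e) (suc V) (positions e (suc V) s) (letters s)   ≡⟨ place-gap-start e (suc V) s (Valid-raise e s v lo≤hi′) ⟩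
      s                                                            ∎)
    where
      open ≡-Reasoning
      e≡0 : e ≡ 0
      e≡0 = gap-empty⇒0 d e de≤k lo≰hi
      lo≤hi′ : lo e ≤ hi (next (letters s))
      lo≤hi′ = subst (λ x → lo x ≤ hi (next (letters s))) (sym e≡0) z≤n
      eq′ : positions e (suc V) s ≡ suc V + t ∷ vs
      eq′ = subst (λ N → positions e N s ≡ suc V + t ∷ vs)
                  (trans (cong (suc V +_) (gapSize-empty d e lo≰hi)) (+-identityʳ _)) eq

  record Encodes (p b N : ℕ) (vs w : List ℕ) (s : List Piece) : Set where
    constructor encodes
    field
      valid       : Valid p b s
      positions-≡ : positions p N s ≡ vs
      letters-≈   : letters s ≈ w

  Encodes-lower : ∀ {p b b′ N vs w s} → b′ ≤ b → Encodes p b N vs w s → Encodes p b′ N vs w s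
  Encodes-lower {s = s} b′≤b (encodes valid pos lets) = encodes (Valid-lower s b′≤b valid) pos lets

  Encodes-cong : ∀ {p b N x x′ vs w w′ s} → x ≡ x′ → w ≈ w′ → Encodes p b N (x ∷ vs) w s → Encodes p b N (x′ ∷ vs) w′ s
  Encodes-cong refl w≈w′ (encodes valid pos lets) = encodes valid pos (≈-trans lets w≈w′)

  Encodes-letter : ∀ {p b N d vs w s} → p + d ≤ k → b ≤ hi d → Encodes d 0 (N + gapSize p d) vs w s →
                   Encodes p b N vs (d ∷ w) (letter d ∷ s)
  Encodes-letter pd≤k b≤hi (encodes valid pos lets) = encodes (pd≤k , b≤hi , valid) pos (∷-≈ refl lets)

  walk-encodes : ∀ c p b N V vs w → V ≡ N + (b ∸ lo p) → Sorted (V + c ∷ vs) →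
                 Admissible k w → p + next w ≤ k → lo p ≤ b → b ≤ hi (next w) →
                 Encodes p b N (V + c ∷ vs) w (walk c p b V vs w)
  place-encodes : ∀ p b N V vs w → V ≡ N + (b ∸ lo p) → Sorted (V ∷ vs) →
                  Admissible k w → p + next w ≤ k → lo p ≤ b → b ≤ hi (next w) →
                  Encodes p b N vs w (place p b V vs w)

  walk-encodes zero p b N V vs w V≡ sorted adm pw lo≤b b≤hi =
    let encodes valid pos lets = place-encodes p b N V vs w V≡ (subst (λ x → Sorted (x ∷ vs)) (+-identityʳ V) sorted) adm pw lo≤b b≤hi
    in encodes (lo≤b , ≤-refl , valid) (cong₂ _∷_ (trans (sym V≡) (sym (+-identityʳ V))) pos) lets
  walk-encodes (suc c) p b N V vs w V≡ sorted adm pw lo≤b b≤hi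
    with b <? hi (next w) | lo (next w) ≤? hi (next (tail₀ w))
  ... | yes b<hi | _ =
    Encodes-cong (sym (+-suc V c)) ≈-refl (Encodes-lower (n≤1+n b)
      (walk-encodes c p (suc b) N (suc V) vs w V+1≡ sorted′ adm pw (≤-trans lo≤b (n≤1+n b)) b<hi))
    where
      sorted′ = subst (λ x → Sorted (x ∷ vs)) (+-suc V c) sorted
      V+1≡ : suc V ≡ N + (suc b ∸ lo p)
      V+1≡ = trans (cong suc V≡) (trans (sym (+-suc N _)) (cong (N +_) (sym (+-∸-assoc 1 lo≤b))))
  ... | no b≮hi | yes lo≤hi =
    Encodes-cong (sym (+-suc V c)) (≈-sym (≈-next∷tail₀ w)) (Encodes-letter pw b≤hi (Encodes-lower z≤n
      (walk-encodes c d (lo d) (N + gapSize p d) (suc V) vs (tail₀ w) V+1≡ sorted′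
                    (admissible-tail₀ w adm) (admissible-next w adm) ≤-refl lo≤hi)))
    where
      d = next w
      sorted′ = subst (λ x → Sorted (x ∷ vs)) (+-suc V c) sorted
      V+1≡ : suc V ≡ N + gapSize p d + (lo d ∸ lo d)
      V+1≡ = trans (suc-V≡gapEnd d V≡ lo≤b (≤-antisym b≤hi (≮⇒≥ b≮hi))) (≡+[n∸n] _ (lo d))
  ... | no b≮hi | no lo≰hi =
    Encodes-cong (sym (+-suc V c)) d∷e∷w″≈w (Encodes-letter pw b≤hi (Encodes-letter (admissible-next w adm) z≤n (Encodes-lower z≤n
      (walk-encodes c e (lo e) (N + gapSize p d + gapSize d e) (suc V) vs w″ V+1≡ sorted′
                    (admissible-tail₀ (tail₀ w) adm′) (admissible-next (tail₀ w) adm′) ≤-refl lo≤hi′))))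
    where
      d = next w
      e = next (tail₀ w)
      w″ = tail₀ (tail₀ w)
      adm′ = admissible-tail₀ w adm
      sorted′ = subst (λ x → Sorted (x ∷ vs)) (+-suc V c) sorted
      d∷e∷w″≈w : d ∷ e ∷ w″ ≈ w
      d∷e∷w″≈w = ≈-trans (∷-≈ refl (≈-sym (≈-next∷tail₀ (tail₀ w)))) (≈-sym (≈-next∷tail₀ w))
      lo≤hi′ : lo e ≤ hi (next w″)
      lo≤hi′ = subst (λ x → lo x ≤ hi (next w″)) (sym (gap-empty⇒0 d e (admissible-next w adm) lo≰hi)) z≤n
      V+1≡ : suc V ≡ N + gapSize p d + gapSize d e + (lo e ∸ lo e)
      V+1≡ = begin
        suc V                                          ≡⟨ suc-V≡gapEnd d V≡ lo≤b (≤-antisym b≤hi (≮⇒≥ b≮hi)) ⟩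
        N + gapSize p d                                ≡⟨ +-identityʳ _ ⟨
        N + gapSize p d + 0                            ≡⟨ cong (N + gapSize p d +_) (gapSize-empty d e lo≰hi) ⟨
        N + gapSize p d + gapSize d e                  ≡⟨ ≡+[n∸n] _ (lo e) ⟩
        N + gapSize p d + gapSize d e + (lo e ∸ lo e)  ∎
        where open ≡-Reasoning

  place-encodes p b N V [] w _ _ adm pw _ b≤hi = map-letter-encodes w p b N adm pw b≤hi
    where
      map-letter-encodes : ∀ w p b N → Admissible k w → p + next w ≤ k → b ≤ hi (next w) → Encodes p b N [] w (map letter w)
      map-letter-encodes []      p b N _                _    b≤k  = encodes b≤k refl ≈-refl
      map-letter-encodes (d ∷ w) p b N (d+next≤k , adm) pd≤k b≤hi =
        Encodes-letter pd≤k b≤hi (map-letter-encodes w d 0 (N + gapSize p d) adm d+next≤k z≤n)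
  place-encodes p b N V (v ∷ vs) w V≡ sorted adm pw lo≤b b≤hi =
    Encodes-cong (m+[n∸m]≡n V≤v) ≈-refl (walk-encodes (v ∸ V) p b N V vs w V≡
      (subst (λ x → Sorted (x ∷ vs)) (sym (m+[n∸m]≡n V≤v)) (Linked.tail sorted)) adm pw lo≤b b≤hi)
    where V≤v = Linked.head sorted

  parse-zeros : ∀ w p N → [] ≈ w → positions p N (parse w) ≡ [] × letters (parse w) ≈ []
  parse-zeros []          p N _      = refl , ≈-refl
  parse-zeros (zero ∷ w)  p N []≈0∷w =
    let pos , lets = parse-zeros w zero (N + gapSize p 0) (proj₂ ([]≈∷ []≈0∷w))
    in pos , ≈-sym ([]≈0∷ (≈-sym lets))
  parse-zeros (suc x ∷ w) p N []≈x∷w with () ← proj₁ ([]≈∷ []≈x∷w)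

  parse-≈ : ∀ v w p N → v ≈ w →
            positions p N (parse v) ≡ positions p N (parse w) × letters (parse v) ≈ letters (parse w)
  parse-≈ []      w       p N []≈w = let pos , lets = parse-zeros w p N []≈w in sym pos , ≈-sym lets
  parse-≈ (x ∷ v) []      p N v≈[] = parse-zeros (x ∷ v) p N (≈-sym v≈[])
  parse-≈ (zero ∷ v) (y ∷ w) p N eq with refl ← ∷-≈-head eq =
    let pos , lets = parse-≈ v w zero (N + gapSize p 0) (∷-≈-tail eq) in pos , ∷-≈ refl lets
  parse-≈ (suc x ∷ v) (y ∷ w) p N eq with refl ← ∷-≈-head eq with x + next v ≟ k | x + next w ≟ k
  ... | yes x+v≡k | no x+w≢k = ⊥-elim (x+w≢k (trans (cong (x +_) (sym (next-≈ (∷-≈-tail eq)))) x+v≡k))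
  ... | no x+v≢k | yes x+w≡k = ⊥-elim (x+v≢k (trans (cong (x +_) (next-≈ (∷-≈-tail eq))) x+w≡k))
  ... | no _ | no _ =
    let pos , lets = parse-≈ v w (suc x) (N + gapSize p (suc x)) (∷-≈-tail eq) in pos , ∷-≈ refl lets
  parse-≈ (suc x ∷ [])    (_ ∷ [])    p N eq | yes _ | yes _ = refl , ≈-refl
  parse-≈ (suc x ∷ [])    (_ ∷ y ∷ w) p N eq | yes _ | yes _ with refl , []≈w ← []≈∷ (∷-≈-tail eq) =
    let pos , lets = parse-zeros w p N []≈w in cong (_ ∷_) (sym pos) , ≈-sym lets
  parse-≈ (suc x ∷ y ∷ v) (_ ∷ [])    p N eq | yes _ | yes _ with refl , []≈v ← []≈∷ (≈-sym (∷-≈-tail eq)) =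
    let pos , lets = parse-zeros v p N []≈v in cong (_ ∷_) pos , lets
  parse-≈ (suc x ∷ y ∷ v) (_ ∷ z ∷ w) p N eq | yes _ | yes _ with refl ← ∷-≈-head (∷-≈-tail eq) =
    let pos , lets = parse-≈ v w p N (∷-≈-tail (∷-≈-tail eq)) in cong (_ ∷_) pos , lets

  place-≈ : ∀ p b V vs v w → v ≈ w → flatten (place p b V vs v) ≈ flatten (place p b V vs w)
  walk-≈  : ∀ c p b V vs v w → v ≈ w → flatten (walk c p b V vs v) ≈ flatten (walk c p b V vs w)

  place-≈ p b V []       v w v≈w = ≈-trans (≈-reflexive (flatten-map-letter v)) (≈-trans v≈w (≈-reflexive (sym (flatten-map-letter w))))
    where
      flatten-map-letter : ∀ w → flatten (map letter w) ≡ w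
      flatten-map-letter []      = refl
      flatten-map-letter (d ∷ w) = cong (d ∷_) (flatten-map-letter w)
  place-≈ p b V (x ∷ vs) v w v≈w = walk-≈ (x ∸ V) p b V vs v w v≈w

  walk-≈ zero    p b V vs v w v≈w = ∷-≈ refl (∷-≈ refl (place-≈ p b V vs v w v≈w))
  walk-≈ (suc c) p b V vs v w v≈w
    with b <? hi (next v) | b <? hi (next w) | lo (next v) ≤? hi (next (tail₀ v)) | lo (next w) ≤? hi (next (tail₀ w))
  ... | yes _   | yes _   | _       | _       = walk-≈ c p (suc b) (suc V) vs v w v≈w
  ... | yes b<v | no b≮w  | _       | _       = ⊥-elim (b≮w (subst (λ d → b < hi d) (next-≈ v≈w) b<v))
  ... | no b≮v  | yes b<w | _       | _       = ⊥-elim (b≮v (subst (λ d → b < hi d) (sym (next-≈ v≈w)) b<w))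
  ... | no _    | no _    | yes v≤  | no w≰   = ⊥-elim (w≰ (subst₂ (λ d e → lo d ≤ hi e) (next-≈ v≈w) (next-≈ (tail₀-≈ v≈w)) v≤))
  ... | no _    | no _    | no v≰   | yes w≤  = ⊥-elim (v≰ (subst₂ (λ d e → lo d ≤ hi e) (sym (next-≈ v≈w)) (sym (next-≈ (tail₀-≈ v≈w))) w≤))
  ... | no _    | no _    | yes _   | yes _   = step (next v) (next w) (next-≈ v≈w)
    where
      step : ∀ d d′ → d ≡ d′ →
             d ∷ flatten (walk c d (lo d) (suc V) vs (tail₀ v)) ≈ d′ ∷ flatten (walk c d′ (lo d′) (suc V) vs (tail₀ w))
      step d .d refl = ∷-≈ refl (walk-≈ c d (lo d) (suc V) vs (tail₀ v) (tail₀ w) (tail₀-≈ v≈w))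
  ... | no _    | no _    | no _    | no _    = step (next v) (next w) (next (tail₀ v)) (next (tail₀ w)) (next-≈ v≈w) (next-≈ (tail₀-≈ v≈w))
    where
      step : ∀ d d′ e e′ → d ≡ d′ → e ≡ e′ →
             d ∷ e ∷ flatten (walk c e (lo e) (suc V) vs (tail₀ (tail₀ v))) ≈ d′ ∷ e′ ∷ flatten (walk c e′ (lo e′) (suc V) vs (tail₀ (tail₀ w)))
      step d .d e .e refl refl = ∷-≈ refl (∷-≈ refl (walk-≈ c e (lo e) (suc V) vs _ _ (tail₀-≈ (tail₀-≈ v≈w))))

  length-positions : ∀ p N s → length (positions p N s) ≡ clusters s
  length-positions p N []              = refl
  length-positions p N (letter d ∷ s)  = length-positions d (N + gapSize p d) s
  length-positions p N (cluster b ∷ s) = cong suc (length-positions p N s)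

  sum-flatten : ∀ p m s → Valid p m s → sum (flatten s) ≡ clusters s * K + sum (letters s)
  sum-flatten p m []              _           = refl
  sum-flatten p m (letter d ∷ s)  (_ , _ , v) =
    trans (cong (d +_) (sum-flatten d 0 s v)) (x∙yz≈y∙xz d (clusters s * K) _)
  sum-flatten p m (cluster b ∷ s) (_ , _ , v) = cong suc (begin
    k ∸ b + (b + sum (flatten s))               ≡⟨ +-assoc (k ∸ b) b _ ⟨
    k ∸ b + b + sum (flatten s)                 ≡⟨ cong₂ _+_ (m∸n+n≡m (Valid⇒≤k p b s v)) (sum-flatten p b s v) ⟩
    k + (clusters s * K + sum (letters s))      ≡⟨ +-assoc k _ _ ⟨
    k + clusters s * K + sum (letters s)        ∎)
    where open ≡-Reasoning

  gapSize+lo+2d : ∀ p d → p + d ≤ k → gapSize p d + lo p + 2 * d ≡ K + lo d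
  gapSize+lo+2d p d pd≤k = trans (cong (_+ 2 * d) (m∸n+n≡m (lo≤suc-hi p d pd≤k))) (suc-hi+2d d (m+n≤o⇒n≤o p pd≤k))
    where
      lo≤suc-hi : ∀ p d → p + d ≤ k → lo p ≤ suc (hi d)
      lo≤suc-hi zero    d       _    = z≤n
      lo≤suc-hi (suc p) zero    p≤k  = s≤s (subst (_≤ k) (+-identityʳ (suc p)) p≤k)
      lo≤suc-hi (suc p) (suc d) pd≤k = s≤s (m+n≤o⇒m≤o∸n (suc p) (≤-trans (+-monoʳ-≤ (suc p) (n≤1+n d)) pd≤k))
      suc-hi+2d : ∀ d → d ≤ k → suc (hi d) + 2 * d ≡ K + lo d
      suc-hi+2d zero    _   = refl
      suc-hi+2d (suc d) d<k = trans (rearrange (k ∸ d) d) (cong (λ x → suc x + suc (suc d)) (m∸n+n≡m (<⇒≤ d<k)))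
        where
          rearrange : ∀ j d → suc j + 2 * suc d ≡ suc (j + d) + suc (suc d)
          rearrange = solve-∀

  -- A cluster b preceded by i clusters and by j letters of total l occupies
  -- entries 2i + j and 2i + j + 1, contributing 2iK + jK + b, and summing
  -- gapSize+lo+2d over those letters shows that jK + b is its position plus
  -- 2l; each letter moves right by twice the number of clusters before it.
  wordWeight-flatten : ∀ p m N s → Valid p m s →
    wordWeight (flatten s) + clusters s * N
      ≡ sumEvens (clusters s) * K + sum (positions p N s) + clusters s * lo p + 2 * clusters s * sum (letters s) + wordWeight (letters s)
  wordWeight-flatten p m N [] _ = refl
  wordWeight-flatten p m N (cluster b ∷ s) (lo≤b , _ , v) = begin
    (b + sum (flatten s)) + (sum (flatten s) + wordWeight (flatten s)) + suc a * N
      ≡⟨ cong₂ (λ x σ → (x + σ) + (σ + wordWeight (flatten s)) + suc a * N) (sym (m∸n+n≡m lo≤b)) (sum-flatten p b s v) ⟩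
    (β + l + (a * K + L)) + ((a * K + L) + wordWeight (flatten s)) + suc a * N
      ≡⟨ regroup β l N a K (wordWeight (flatten s)) L ⟩
    (wordWeight (flatten s) + a * N) + (β + l + 2 * (a * K) + 2 * L + N)
      ≡⟨ cong (_+ (β + l + 2 * (a * K) + 2 * L + N)) (wordWeight-flatten p b N s v) ⟩
    (sumEvens a * K + S + a * l + 2 * a * L + wordWeight (letters s)) + (β + l + 2 * (a * K) + 2 * L + N)
      ≡⟨ regroup′ β l N a K (sumEvens a) S L (wordWeight (letters s)) ⟩
    (sumEvens a + 2 * a) * K + ((N + β) + S) + suc a * l + 2 * suc a * L + wordWeight (letters s) ∎
    where
      open ≡-Reasoning
      a = clusters s
      l = lo p
      β = b ∸ lo p
      L = sum (letters s)
      S = sum (positions p N s)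
      regroup : ∀ β l N a K ω L →
                (β + l + (a * K + L)) + ((a * K + L) + ω) + suc a * N ≡ (ω + a * N) + (β + l + 2 * (a * K) + 2 * L + N)
      regroup = solve-∀
      regroup′ : ∀ β l N a K t S L ω →
                 (t * K + S + a * l + 2 * a * L + ω) + (β + l + 2 * (a * K) + 2 * L + N)
                   ≡ (t + 2 * a) * K + ((N + β) + S) + suc a * l + 2 * suc a * L + ω
      regroup′ = solve-∀
  wordWeight-flatten p m N (letter d ∷ s) (pd≤k , _ , v) = +-cancelʳ-≡ (a * g) _ _ (begin
    (sum (flatten s) + wordWeight (flatten s)) + a * N + a * g
      ≡⟨ cong (λ σ → (σ + wordWeight (flatten s)) + a * N + a * g) (sum-flatten d 0 s v) ⟩
    ((a * K + L) + wordWeight (flatten s)) + a * N + a * g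
      ≡⟨ regroup a N g K (wordWeight (flatten s)) L ⟩
    (wordWeight (flatten s) + a * (N + g)) + (a * K + L)
      ≡⟨ cong (_+ (a * K + L)) (wordWeight-flatten d 0 (N + g) s v) ⟩
    (sumEvens a * K + S + a * lo d + 2 * a * L + wordWeight (letters s)) + (a * K + L)
      ≡⟨ regroup′ a K (lo d) (sumEvens a) S L (wordWeight (letters s)) ⟩
    sumEvens a * K + S + a * (K + lo d) + 2 * a * L + L + wordWeight (letters s)
      ≡⟨ cong (λ x → sumEvens a * K + S + a * x + 2 * a * L + L + wordWeight (letters s)) (gapSize+lo+2d p d pd≤k) ⟨
    sumEvens a * K + S + a * (g + lo p + 2 * d) + 2 * a * L + L + wordWeight (letters s)
      ≡⟨ regroup″ a g (lo p) d (sumEvens a) K S L (wordWeight (letters s)) ⟩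
    sumEvens a * K + S + a * lo p + 2 * a * (d + L) + (L + wordWeight (letters s)) + a * g ∎)
    where
      open ≡-Reasoning
      a = clusters s
      g = gapSize p d
      L = sum (letters s)
      S = sum (positions d (N + g) s)
      regroup : ∀ a N g K ω L → ((a * K + L) + ω) + a * N + a * g ≡ (ω + a * (N + g)) + (a * K + L)
      regroup = solve-∀
      regroup′ : ∀ a K l t S L ω → (t * K + S + a * l + 2 * a * L + ω) + (a * K + L) ≡ t * K + S + a * (K + l) + 2 * a * L + L + ω
      regroup′ = solve-∀
      regroup″ : ∀ a g l d t K S L ω →
                 t * K + S + a * (g + l + 2 * d) + 2 * a * L + L + ω ≡ t * K + S + a * l + 2 * a * (d + L) + (L + ω) + a * g
      regroup″ = solve-∀

  insert : List ℕ → List ℕ → List ℕ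
  insert ν w = flatten (place 0 0 0 ν w)

  clusterPositions : List ℕ → List ℕ
  clusterPositions w = positions 0 0 (parse w)

  remainder : List ℕ → List ℕ
  remainder w = letters (parse w)

  module _ {w : List ℕ} (adm : Admissible K w) where
    private
      valid : Valid 0 0 (parse w)
      valid = parse-valid w 0 0 adm (next≤ w adm) z≤n (inj₁ refl)

    insert-extract : insert (clusterPositions w) (remainder w) ≈ w
    insert-extract = ≈-trans (≈-reflexive (cong flatten (place-positions (parse w) 0 0 0 valid z≤n))) (flatten-parse w)

    clusterPositions-sorted : Sorted (clusterPositions w)
    clusterPositions-sorted = Linked.tail (positions-sorted 0 0 0 (parse w) valid)

    remainder-admissible : Admissible k (remainder w)
    remainder-admissible = proj₁ (letters-admissible 0 0 (parse w) valid z≤n)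

  extract-≈ : ∀ {v w} → v ≈ w → clusterPositions v ≡ clusterPositions w × remainder v ≈ remainder w
  extract-≈ {v} {w} = parse-≈ v w 0 0

  insert-≈ : ∀ ν {v w} → v ≈ w → insert ν v ≈ insert ν w
  insert-≈ ν {v} {w} = place-≈ 0 0 0 ν v w

  module _ {ν w : List ℕ} (sorted : Sorted ν) (adm : Admissible k w) where
    private
      s = place 0 0 0 ν w
      open Encodes (place-encodes 0 0 0 0 ν w refl (0∷-sorted sorted) adm (next≤ w adm) z≤n z≤n)

      clusters≡ : clusters s ≡ length ν
      clusters≡ = trans (sym (length-positions 0 0 s)) (cong length positions-≡)

    extract-insert : clusterPositions (insert ν w) ≡ ν × remainder (insert ν w) ≈ w
    extract-insert rewrite parse-flatten 0 0 s valid = positions-≡ , letters-≈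

    insert-admissible : Admissible K (insert ν w)
    insert-admissible = flatten-admissible 0 0 s valid

    sum-insert : sum (insert ν w) ≡ length ν * K + sum w
    sum-insert = begin
      sum (flatten s)                     ≡⟨ sum-flatten 0 0 s valid ⟩
      clusters s * K + sum (letters s)    ≡⟨ cong₂ (λ a σ → a * K + σ) clusters≡ (sum-≈ letters-≈) ⟩
      length ν * K + sum w                ∎
      where open ≡-Reasoning

    wordWeight-insert : wordWeight (insert ν w) ≡ sumEvens (length ν) * K + sum ν + 2 * length ν * sum w + wordWeight w
    wordWeight-insert = begin
      wordWeight (flatten s)
        ≡⟨ +-*-zeroʳ (wordWeight (flatten s)) a ⟨
      wordWeight (flatten s) + a * 0
        ≡⟨ wordWeight-flatten 0 0 0 s valid ⟩
      sumEvens a * K + sum (positions 0 0 s) + a * 0 + 2 * a * sum (letters s) + wordWeight (letters s)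
        ≡⟨ cong (λ x → x + 2 * a * sum (letters s) + wordWeight (letters s)) (+-*-zeroʳ _ a) ⟩
      sumEvens a * K + sum (positions 0 0 s) + 2 * a * sum (letters s) + wordWeight (letters s)
        ≡⟨ cong₂ (λ S σ → sumEvens a * K + S + 2 * a * σ + wordWeight (letters s)) (cong sum positions-≡) (sum-≈ letters-≈) ⟩
      sumEvens a * K + sum ν + 2 * a * sum w + wordWeight (letters s)
        ≡⟨ cong₂ (λ n ω → sumEvens n * K + sum ν + 2 * n * sum w + ω) clusters≡ (wordWeight-≈ letters-≈) ⟩
      sumEvens (length ν) * K + sum ν + 2 * length ν * sum w + wordWeight w ∎
      where
        open ≡-Reasoning
        a = clusters s
        +-*-zeroʳ : ∀ x a → x + a * 0 ≡ x
        +-*-zeroʳ x a = trans (cong (x +_) (*-zeroʳ a)) (+-identityʳ x)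

-- Iterated insertion

open Insertion using (insert; clusterPositions; remainder)

build : ℕ → List (List ℕ) → List ℕ
build zero    _        = []
build (suc k) []       = []
build (suc k) (ν ∷ νs) = insert k ν (build k νs)

unbuild : ℕ → List ℕ → List (List ℕ)
unbuild zero    w = []
unbuild (suc k) w = clusterPositions k w ∷ unbuild k (remainder k w)

build-admissible : ∀ K νs → All Sorted νs → length νs ≡ K → Admissible K (build K νs)
build-admissible zero    []       _        _  = tt
build-admissible (suc k) (ν ∷ νs) (s ∷ ss) eq =
  Insertion.insert-admissible k s (build-admissible k νs ss (suc-injective eq))

unbuild-≈ : ∀ K {v w} → v ≈ w → unbuild K v ≡ unbuild K w
unbuild-≈ zero    _   = refl
unbuild-≈ (suc k) v≈w =
  let pos , rem = Insertion.extract-≈ k v≈w in cong₂ _∷_ pos (unbuild-≈ k rem)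

unbuild-build : ∀ K νs → All Sorted νs → length νs ≡ K → unbuild K (build K νs) ≡ νs
unbuild-build zero    []       _        _  = refl
unbuild-build (suc k) (ν ∷ νs) (s ∷ ss) eq =
  let pos , rem = Insertion.extract-insert k s (build-admissible k νs ss (suc-injective eq))
  in cong₂ _∷_ pos (trans (unbuild-≈ k rem) (unbuild-build k νs ss (suc-injective eq)))

unbuild-sorted : ∀ K w → Admissible K w → All Sorted (unbuild K w)
unbuild-sorted zero    w _   = []
unbuild-sorted (suc k) w adm =
  Insertion.clusterPositions-sorted k adm ∷ unbuild-sorted k (remainder k w) (Insertion.remainder-admissible k adm)

length-unbuild : ∀ K w → length (unbuild K w) ≡ K
length-unbuild zero    w = refl
length-unbuild (suc k) w = cong suc (length-unbuild k (remainder k w))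

build-unbuild : ∀ K w → Admissible K w → build K (unbuild K w) ≈ w
build-unbuild zero    w adm = admissible-zero w adm
build-unbuild (suc k) w adm =
  ≈-trans (Insertion.insert-≈ k (clusterPositions k w) (build-unbuild k (remainder k w) (Insertion.remainder-admissible k adm)))
          (Insertion.insert-extract k adm)

-- For the blocks ν₁, …, ν_K of λ, outermost first, `boundaries` gives
-- s_j = |ν_j| + ⋯ + |ν_K| and `joinBlocks` gives λ = ν_K ++ ⋯ ++ ν₁.
boundaries : List (List ℕ) → List ℕ
boundaries []       = []
boundaries (ν ∷ νs) = length ν + next (boundaries νs) ∷ boundaries νs

joinBlocks : List (List ℕ) → List ℕ
joinBlocks []       = []
joinBlocks (ν ∷ νs) = joinBlocks νs ++ ν

boundaries-∷ʳ : ∀ νs ν → boundaries (νs ∷ʳ ν) ≡ map (length ν +_) (boundaries νs) ∷ʳ length ν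
boundaries-∷ʳ []       ν = cong (_∷ []) (+-identityʳ (length ν))
boundaries-∷ʳ (μ ∷ νs) ν = cong₂ _∷_ head-≡ (boundaries-∷ʳ νs ν)
  where
    next-map-∷ʳ : ∀ a S → next (map (a +_) S ∷ʳ a) ≡ a + next S
    next-map-∷ʳ a []      = sym (+-identityʳ a)
    next-map-∷ʳ a (_ ∷ _) = refl
    head-≡ : length μ + next (boundaries (νs ∷ʳ ν)) ≡ length ν + (length μ + next (boundaries νs))
    head-≡ = begin
      length μ + next (boundaries (νs ∷ʳ ν))                          ≡⟨ cong (λ S → length μ + next S) (boundaries-∷ʳ νs ν) ⟩
      length μ + next (map (length ν +_) (boundaries νs) ∷ʳ length ν) ≡⟨ cong (length μ +_) (next-map-∷ʳ (length ν) (boundaries νs)) ⟩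
      length μ + (length ν + next (boundaries νs))                    ≡⟨ x∙yz≈y∙xz (length μ) (length ν) _ ⟩
      length ν + (length μ + next (boundaries νs))                    ∎
      where open ≡-Reasoning

joinBlocks-∷ʳ : ∀ νs ν → joinBlocks (νs ∷ʳ ν) ≡ ν ++ joinBlocks νs
joinBlocks-∷ʳ []       ν = sym (++-identityʳ ν)
joinBlocks-∷ʳ (μ ∷ νs) ν = trans (cong (_++ μ) (joinBlocks-∷ʳ νs ν)) (++-assoc ν (joinBlocks νs) μ)

length-boundaries : ∀ νs → length (boundaries νs) ≡ length νs
length-boundaries []       = refl
length-boundaries (_ ∷ νs) = cong suc (length-boundaries νs)

sum-map-+ : ∀ a S → sum (map (a +_) S) ≡ length S * a + sum S
sum-map-+ a []      = refl
sum-map-+ a (x ∷ S) = trans (cong (a + x +_) (sum-map-+ a S)) (rearrange a x (length S) (sum S))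
  where
    rearrange : ∀ a x l σ → a + x + (l * a + σ) ≡ suc l * a + (x + σ)
    rearrange = solve-∀

sum-sumEvens-map-+ : ∀ a S → sum (map sumEvens (map (a +_) S)) ≡ length S * sumEvens a + sum (map sumEvens S) + 2 * a * sum S
sum-sumEvens-map-+ a []      = sym (*-zeroʳ (2 * a))
sum-sumEvens-map-+ a (x ∷ S) =
  trans (cong₂ _+_ (sumEvens-+ a x) (sum-sumEvens-map-+ a S)) (rearrange (sumEvens a) (sumEvens x) a x (sum (map sumEvens S)) (length S) (sum S))
  where
    rearrange : ∀ ta tx a x τ l σ → ta + tx + 2 * a * x + (l * ta + τ + 2 * a * σ) ≡ suc l * ta + (tx + τ) + 2 * a * (x + σ)
    rearrange = solve-∀

length-boundaries-reverse : ∀ {K} νs → length νs ≡ K → length (boundaries (reverse νs)) ≡ K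
length-boundaries-reverse νs eq = trans (length-boundaries (reverse νs)) (trans (length-reverse νs) eq)

boundaries-reverse-∷ : ∀ ν νs → boundaries (reverse (ν ∷ νs)) ≡ map (length ν +_) (boundaries (reverse νs)) ∷ʳ length ν
boundaries-reverse-∷ ν νs = trans (cong boundaries (unfold-reverse ν νs)) (boundaries-∷ʳ (reverse νs) ν)

sum-build : ∀ K νs → All Sorted νs → length νs ≡ K → sum (build K νs) ≡ sum (boundaries (reverse νs))
sum-build zero    []       _        _  = refl
sum-build (suc k) (ν ∷ νs) (s ∷ ss) eq = begin
  sum (insert k ν (build k νs))             ≡⟨ Insertion.sum-insert k s (build-admissible k νs ss eq′) ⟩
  a * suc k + sum (build k νs)              ≡⟨ cong (a * suc k +_) (sum-build k νs ss eq′) ⟩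
  a * suc k + sum S                         ≡⟨ rearrange k a (sum S) ⟩
  k * a + sum S + (a + 0)                   ≡⟨ cong (λ l → l * a + sum S + (a + 0)) (length-boundaries-reverse νs eq′) ⟨
  length S * a + sum S + (a + 0)            ≡⟨ cong (_+ (a + 0)) (sum-map-+ a S) ⟨
  sum (map (a +_) S) + (a + 0)              ≡⟨ sum-++ (map (a +_) S) (a ∷ []) ⟨
  sum (map (a +_) S ∷ʳ a)                   ≡⟨ cong sum (boundaries-reverse-∷ ν νs) ⟨
  sum (boundaries (reverse (ν ∷ νs)))       ∎
  where
    open ≡-Reasoning
    eq′ = suc-injective eq
    a = length ν
    S = boundaries (reverse νs)
    rearrange : ∀ k a σ → a * suc k + σ ≡ k * a + σ + (a + 0)
    rearrange = solve-∀

wordWeight-build : ∀ K νs → All Sorted νs → length νs ≡ K →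
  wordWeight (build K νs) ≡ sum (map sumEvens (boundaries (reverse νs))) + sum (joinBlocks (reverse νs))
wordWeight-build zero    []       _        _  = refl
wordWeight-build (suc k) (ν ∷ νs) (s ∷ ss) eq = begin
  wordWeight (insert k ν W)
    ≡⟨ Insertion.wordWeight-insert k s (build-admissible k νs ss eq′) ⟩
  sumEvens a * suc k + sum ν + 2 * a * sum W + wordWeight W
    ≡⟨ cong₂ (λ σ ω → sumEvens a * suc k + sum ν + 2 * a * σ + ω) (sum-build k νs ss eq′) (wordWeight-build k νs ss eq′) ⟩
  sumEvens a * suc k + sum ν + 2 * a * sum S + (sum (map sumEvens S) + sum Λ)
    ≡⟨ rearrange k a (sumEvens a) (sum ν) (sum S) (sum (map sumEvens S)) (sum Λ) ⟩
  (k * sumEvens a + sum (map sumEvens S) + 2 * a * sum S) + (sumEvens a + 0) + (sum ν + sum Λ)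
    ≡⟨ cong (λ l → (l * sumEvens a + sum (map sumEvens S) + 2 * a * sum S) + (sumEvens a + 0) + (sum ν + sum Λ))
            (length-boundaries-reverse νs eq′) ⟨
  (length S * sumEvens a + sum (map sumEvens S) + 2 * a * sum S) + (sumEvens a + 0) + (sum ν + sum Λ)
    ≡⟨ cong₂ (λ x y → x + (sumEvens a + 0) + y) (sum-sumEvens-map-+ a S) (sum-++ ν Λ) ⟨
  sum (map sumEvens (map (a +_) S)) + (sumEvens a + 0) + sum (ν ++ Λ)
    ≡⟨ cong (_+ sum (ν ++ Λ)) (trans (cong sum (map-++ sumEvens (map (a +_) S) (a ∷ []))) (sum-++ (map sumEvens (map (a +_) S)) _)) ⟨
  sum (map sumEvens (map (a +_) S ∷ʳ a)) + sum (ν ++ Λ)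
    ≡⟨ cong₂ (λ B ys → sum (map sumEvens B) + sum ys) (boundaries-reverse-∷ ν νs)
             (trans (cong joinBlocks (unfold-reverse ν νs)) (joinBlocks-∷ʳ (reverse νs) ν)) ⟨
  sum (map sumEvens (boundaries (reverse (ν ∷ νs)))) + sum (joinBlocks (reverse (ν ∷ νs))) ∎
  where
    open ≡-Reasoning
    eq′ = suc-injective eq
    a = length ν
    W = build k νs
    S = boundaries (reverse νs)
    Λ = joinBlocks (reverse νs)
    rearrange : ∀ k a t σν σ τ σJ →
      t * suc k + σν + 2 * a * σ + (τ + σJ) ≡ (k * t + τ + 2 * a * σ) + (t + 0) + (σν + σJ)
    rearrange = solve-∀

-- Cutting λ into blocks

blocks : List ℕ → List ℕ → List (List ℕ)
blocks []      lam = []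
blocks (_ ∷ s) lam = drop (next s) lam ∷ blocks s (take (next s) lam)

length-blocks : ∀ s lam → length (blocks s lam) ≡ length s
length-blocks []      lam = refl
length-blocks (_ ∷ s) lam = cong suc (length-blocks s _)

length-joinBlocks : ∀ νs → length (joinBlocks νs) ≡ next (boundaries νs)
length-joinBlocks []       = refl
length-joinBlocks (ν ∷ νs) =
  trans (length-++ (joinBlocks νs)) (trans (cong (_+ length ν) (length-joinBlocks νs)) (+-comm _ (length ν)))

boundaries-nonIncreasing : ∀ νs → NonIncreasing (boundaries νs)
boundaries-nonIncreasing []           = []
boundaries-nonIncreasing (_ ∷ [])     = [-]
boundaries-nonIncreasing (ν ∷ μ ∷ νs) = m≤n+m _ (length ν) ∷ boundaries-nonIncreasing (μ ∷ νs)

blocks-boundaries : ∀ νs → blocks (boundaries νs) (joinBlocks νs) ≡ νs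
blocks-boundaries []       = refl
blocks-boundaries (ν ∷ νs) rewrite sym (length-joinBlocks νs) =
  cong₂ _∷_ (drop-length-++ (joinBlocks νs) ν)
            (trans (cong (blocks (boundaries νs)) (take-length-++ (joinBlocks νs) ν)) (blocks-boundaries νs))

length-take-next : ∀ {a} s (lam : List ℕ) → NonIncreasing (a ∷ s) → length lam ≡ a → length (take (next s) lam) ≡ next s
length-take-next s lam ni eq = trans (length-take (next s) lam) (m≤n⇒m⊓n≡m (subst (next s ≤_) (sym eq) (next≤head s ni)))

boundaries-blocks : ∀ s lam → NonIncreasing s → length lam ≡ next s →
                    boundaries (blocks s lam) ≡ s × joinBlocks (blocks s lam) ≡ lam
boundaries-blocks []      lam _  eq = refl , sym (length≡0⇒[] eq)
  where
    length≡0⇒[] : ∀ {xs : List ℕ} → length xs ≡ 0 → xs ≡ []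
    length≡0⇒[] {[]} _ = refl
boundaries-blocks (a ∷ s) lam ni eq =
  let bs , js = boundaries-blocks s (take (next s) lam) (Linked.tail ni) (length-take-next s lam ni eq)
  in cong₂ _∷_ (begin
       length (drop (next s) lam) + next (boundaries (blocks s (take (next s) lam)))
         ≡⟨ cong₂ _+_ (trans (length-drop (next s) lam) (cong (_∸ next s) eq)) (cong next bs) ⟩
       a ∸ next s + next s
         ≡⟨ m∸n+n≡m (next≤head s ni) ⟩
       a ∎) bs ,
     trans (cong (_++ drop (next s) lam) js) (take++drop≡id (next s) lam)
  where open ≡-Reasoning

-- The monotonicity condition of IsP with j shifted by one and without its
-- bound: beyond the length of s the interval is empty since `at s j = 0`.
SortedOnBlocks : List ℕ → List ℕ → Set
SortedOnBlocks s lam = ∀ j i → at s (suc j) ≤ i → suc i < at s j → at lam i ≤ at lam (suc i)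

module _ {a : ℕ} (s lam : List ℕ) (ni : NonIncreasing (a ∷ s)) (len : length lam ≡ a) where
  private
    b = next s

    b≤a : b ≤ a
    b≤a = next≤head s ni

    length-drop-b : length (drop b lam) ≡ a ∸ b
    length-drop-b = trans (length-drop b lam) (cong (_∸ b) len)

    <at⇒<b : ∀ {i} j → suc i < at s j → suc i < b
    <at⇒<b j lt = ≤-trans lt (at≤next (Linked.tail ni) j)

  sortedOnBlocks-tail : SortedOnBlocks (a ∷ s) lam → SortedOnBlocks s (take b lam)
  sortedOnBlocks-tail sorted j i lo≤i i<hi =
    subst₂ _≤_ (sym (at-take b lam i (<⇒≤ (<at⇒<b j i<hi)))) (sym (at-take b lam (suc i) (<at⇒<b j i<hi)))
      (sorted (suc j) i lo≤i i<hi)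

  sortedOnBlocks-head : SortedOnBlocks (a ∷ s) lam → Sorted (drop b lam)
  sortedOnBlocks-head sorted = at⇒sorted (drop b lam) λ i i<n →
    subst₂ _≤_ (sym (at-drop b lam i)) (trans (cong (at lam) (sym (+-suc b i))) (sym (at-drop b lam (suc i))))
      (sorted 0 (b + i) (subst (_≤ b + i) (sym (at-zero s)) (m≤m+n b i)) (begin-strict
        suc (b + i)   ≡⟨ +-suc b i ⟨
        b + suc i     <⟨ +-monoʳ-< b (subst (suc i <_) length-drop-b i<n) ⟩
        b + (a ∸ b)   ≡⟨ m+[n∸m]≡n b≤a ⟩
        a             ∎))
    where open ≤-Reasoning

  sortedOnBlocks-∷ : Sorted (drop b lam) → SortedOnBlocks s (take b lam) → SortedOnBlocks (a ∷ s) lam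
  sortedOnBlocks-∷ sorted-head _ zero i b≤i i<a =
    subst₂ _≤_ (trans (at-drop b lam (i ∸ b)) (cong (at lam) (m+[n∸m]≡n b≤i′)))
               (trans (at-drop b lam (suc (i ∸ b))) (cong (at lam) (trans (+-suc b (i ∸ b)) (cong suc (m+[n∸m]≡n b≤i′)))))
      (sorted⇒at sorted-head (i ∸ b) (begin-strict
        suc (i ∸ b)        ≡⟨ +-∸-assoc 1 b≤i′ ⟨
        suc i ∸ b          <⟨ ∸-monoˡ-< i<a (≤-trans b≤i′ (n≤1+n i)) ⟩
        a ∸ b              ≡⟨ length-drop-b ⟨
        length (drop b lam) ∎))
    where
      open ≤-Reasoning
      b≤i′ : b ≤ i
      b≤i′ = subst (_≤ i) (at-zero s) b≤i
  sortedOnBlocks-∷ _ sorted-tail (suc j) i lo≤i i<hi =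
    subst₂ _≤_ (at-take b lam i (<⇒≤ (<at⇒<b j i<hi))) (at-take b lam (suc i) (<at⇒<b j i<hi))
      (sorted-tail j i lo≤i i<hi)

sortedOnBlocks⇒sorted : ∀ s lam → NonIncreasing s → length lam ≡ next s → SortedOnBlocks s lam → All Sorted (blocks s lam)
sortedOnBlocks⇒sorted []      lam _  _   _      = []
sortedOnBlocks⇒sorted (a ∷ s) lam ni len sorted =
  sortedOnBlocks-head s lam ni len sorted ∷
  sortedOnBlocks⇒sorted s (take (next s) lam) (Linked.tail ni) (length-take-next s lam ni len) (sortedOnBlocks-tail s lam ni len sorted)

sorted⇒sortedOnBlocks : ∀ s lam → NonIncreasing s → length lam ≡ next s → All Sorted (blocks s lam) → SortedOnBlocks s lam
sorted⇒sortedOnBlocks []      lam _  _   _ j i _ ()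
sorted⇒sortedOnBlocks (a ∷ s) lam ni len (sorted-head ∷ sorted-tail) =
  sortedOnBlocks-∷ s lam ni len sorted-head
    (sorted⇒sortedOnBlocks s (take (next s) lam) (Linked.tail ni) (length-take-next s lam ni len) sorted-tail)

-- The staircase μ(s)

module _ (j : ℕ) where
  private
    copies : ℕ → List ℕ
    copies u = replicate j (2 * u)

  sum-concatMap-copies : ∀ xs → sum (concatMap copies xs) ≡ j * (2 * sum xs)
  sum-concatMap-copies []       = sym (*-zeroʳ j)
  sum-concatMap-copies (x ∷ xs) = begin
    sum (copies x ++ concatMap copies xs)        ≡⟨ sum-++ (copies x) _ ⟩
    sum (copies x) + sum (concatMap copies xs)   ≡⟨ cong₂ _+_ (sum-replicate j (2 * x)) (sum-concatMap-copies xs) ⟩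
    j * (2 * x) + j * (2 * sum xs)               ≡⟨ rearrange j x (sum xs) ⟩
    j * (2 * (x + sum xs))                       ∎
    where
      open ≡-Reasoning
      sum-replicate : ∀ n c → sum (replicate n c) ≡ n * c
      sum-replicate zero    c = refl
      sum-replicate (suc n) c = cong (c +_) (sum-replicate n c)
      rearrange : ∀ j x σ → j * (2 * x) + j * (2 * σ) ≡ j * (2 * (x + σ))
      rearrange = solve-∀

  length-concatMap-copies : ∀ xs → length (concatMap copies xs) ≡ j * length xs
  length-concatMap-copies []       = sym (*-zeroʳ j)
  length-concatMap-copies (x ∷ xs) = begin
    length (copies x ++ concatMap copies xs)           ≡⟨ length-++ (copies x) ⟩
    length (copies x) + length (concatMap copies xs)   ≡⟨ cong₂ _+_ (length-replicate j) (length-concatMap-copies xs) ⟩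
    j + j * length xs                                  ≡⟨ *-suc j (length xs) ⟨
    j * suc (length xs)                                ∎
    where open ≡-Reasoning

sumEvens-applyUpTo : ∀ b n → 2 * sum (applyUpTo (b +_) n) + sumEvens b ≡ sumEvens (b + n)
sumEvens-applyUpTo b zero    = cong sumEvens (sym (+-identityʳ b))
sumEvens-applyUpTo b (suc n) = begin
  2 * sum (applyUpTo (b +_) (suc n)) + sumEvens b           ≡⟨ cong (λ xs → 2 * sum xs + sumEvens b) (applyUpTo-∷ʳ (b +_) n) ⟨
  2 * sum (applyUpTo (b +_) n ++ b + n ∷ []) + sumEvens b   ≡⟨ cong (λ σ → 2 * σ + sumEvens b) (sum-++ (applyUpTo (b +_) n) _) ⟩
  2 * (sum (applyUpTo (b +_) n) + (b + n + 0)) + sumEvens b ≡⟨ rearrange (sum (applyUpTo (b +_) n)) (b + n) (sumEvens b) ⟩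
  2 * sum (applyUpTo (b +_) n) + sumEvens b + 2 * (b + n)   ≡⟨ cong (_+ 2 * (b + n)) (sumEvens-applyUpTo b n) ⟩
  sumEvens (suc (b + n))                                    ≡⟨ cong sumEvens (+-suc b n) ⟨
  sumEvens (b + suc n)                                      ∎
  where
    open ≡-Reasoning
    rearrange : ∀ σ m t → 2 * (σ + (m + 0)) + t ≡ 2 * σ + t + 2 * m
    rearrange = solve-∀

sumEvens-range : ∀ {b a} → b ≤ a → 2 * sum (range b a) + sumEvens b ≡ sumEvens a
sumEvens-range {b} {a} b≤a = begin
  2 * sum (range b a) + sumEvens b                   ≡⟨ cong (λ xs → 2 * sum xs + sumEvens b) (map-upTo (b +_) (a ∸ b)) ⟩
  2 * sum (applyUpTo (b +_) (a ∸ b)) + sumEvens b    ≡⟨ sumEvens-applyUpTo b (a ∸ b) ⟩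
  sumEvens (b + (a ∸ b))                             ≡⟨ cong sumEvens (m+[n∸m]≡n b≤a) ⟩
  sumEvens a                                         ∎
  where open ≡-Reasoning

length-range : ∀ b a → length (range b a) ≡ a ∸ b
length-range b a = trans (cong length (map-upTo (b +_) (a ∸ b))) (length-applyUpTo (b +_) (a ∸ b))

weight-muParts : ∀ j s → NonIncreasing s → weight (muParts (suc j) s) ≡ sum (map sumEvens s) + j * sumEvens (next s)
weight-muParts j []      _  = sym (*-zeroʳ j)
weight-muParts j (a ∷ s) ni = begin
  sum (R ++ muParts (suc (suc j)) s)                          ≡⟨ sum-++ R _ ⟩
  sum R + weight (muParts (suc (suc j)) s)                    ≡⟨ cong₂ _+_ (sum-concatMap-copies (suc j) (range b a)) (weight-muParts (suc j) s (Linked.tail ni)) ⟩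
  suc j * (2 * sum (range b a)) + (τ + suc j * sumEvens b)    ≡⟨ rearrange j (2 * sum (range b a)) (sumEvens b) τ ⟩
  suc j * (2 * sum (range b a) + sumEvens b) + τ              ≡⟨ cong (λ t → suc j * t + τ) (sumEvens-range (next≤head s ni)) ⟩
  suc j * sumEvens a + τ                                      ≡⟨ rearrange′ j (sumEvens a) τ ⟩
  sumEvens a + τ + j * sumEvens a                             ∎
  where
    open ≡-Reasoning
    b = next s
    R = concatMap (λ u → replicate (suc j) (2 * u)) (range b a)
    τ = sum (map sumEvens s)
    rearrange : ∀ j x t τ → suc j * x + (τ + suc j * t) ≡ suc j * (x + t) + τ
    rearrange = solve-∀
    rearrange′ : ∀ j t τ → suc j * t + τ ≡ t + τ + j * t
    rearrange′ = solve-∀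

length-muParts : ∀ j s → NonIncreasing s → length (muParts (suc j) s) ≡ sum s + j * next s
length-muParts j []      _  = sym (*-zeroʳ j)
length-muParts j (a ∷ s) ni = begin
  length (R ++ muParts (suc (suc j)) s)                   ≡⟨ length-++ R ⟩
  length R + length (muParts (suc (suc j)) s)             ≡⟨ cong₂ _+_ (length-concatMap-copies (suc j) (range b a)) (length-muParts (suc j) s (Linked.tail ni)) ⟩
  suc j * length (range b a) + (sum s + suc j * b)        ≡⟨ cong (λ n → suc j * n + (sum s + suc j * b)) (length-range b a) ⟩
  suc j * (a ∸ b) + (sum s + suc j * b)                   ≡⟨ rearrange j (a ∸ b) b (sum s) ⟩
  suc j * (b + (a ∸ b)) + sum s                           ≡⟨ cong (λ x → suc j * x + sum s) (m+[n∸m]≡n (next≤head s ni)) ⟩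
  suc j * a + sum s                                       ≡⟨ rearrange′ j a (sum s) ⟩
  a + sum s + j * a                                       ∎
  where
    open ≡-Reasoning
    b = next s
    R = concatMap (λ u → replicate (suc j) (2 * u)) (range b a)
    rearrange : ∀ j n b σ → suc j * n + (σ + suc j * b) ≡ suc j * (b + n) + σ
    rearrange = solve-∀
    rearrange′ : ∀ j a σ → suc j * a + σ ≡ a + σ + j * a
    rearrange′ = solve-∀

weight-mu : ∀ s → NonIncreasing s → weight (mu s) ≡ sum (map sumEvens s)
weight-mu s ni = trans (weight-muParts 0 s ni) (+-identityʳ _)

length-mu : ∀ s → NonIncreasing s → length (mu s) ≡ sum s
length-mu s ni = trans (length-muParts 0 s ni) (+-identityʳ _)

-- The bijection

module Bijection (k : ℕ) where

  K : ℕ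
  K = suc k

  r : ℕ
  r = suc K

  admissible⇒isA : ∀ {w} → Admissible K w → IsA r (partitionOf w)
  admissible⇒isA {w} adm =
    partitionOf-nonIncreasing w ,
    subst (_≤ K) (sym (mult-partitionOf w 0)) (≤-trans (m≤m+n _ _) (admissible⇒at w adm 0)) ,
    λ u → subst (_≤ K) (sym (cong₂ _+_ (mult-partitionOf w u) (mult-partitionOf w (suc u)))) (admissible⇒at w adm u)

  isA⇒admissible : ∀ {y} → IsA r y → Admissible K (multiplicities y)
  isA⇒admissible {y} (_ , _ , pairs) = at⇒admissible (multiplicities y) λ u →
    subst (_≤ K) (sym (cong₂ _+_ (at-multiplicities y u) (at-multiplicities y (suc u)))) (pairs u)

  isP⇒sortedOnBlocks : ∀ s lam → IsP r s lam → SortedOnBlocks s lam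
  isP⇒sortedOnBlocks s _ (len-s , _ , _ , mono) j i lo≤i i<hi with j <? length s
  ... | yes j<len = mono (suc j) (s≤s z≤n) (subst (suc j ≤_) len-s j<len) i lo≤i i<hi
  ... | no  j≮len = ⊥-elim (<⇒≱ i<hi (subst (_≤ suc i) (sym (at-≥length s (≮⇒≥ j≮len))) z≤n))

  sortedOnBlocks⇒mono : ∀ s lam → SortedOnBlocks s lam →
    ∀ j → 1 ≤ j → j ≤ r ∸ 1 → ∀ i → sAt s (suc j) ≤ i → suc i < sAt s j → at lam i ≤ at lam (suc i)
  sortedOnBlocks⇒mono _ _ sorted (suc j) _ _ = sorted j

  module _ (s lam : List ℕ) (isP : IsP r s lam) where
    private
      len-lam : length lam ≡ next s
      len-lam = trans (proj₁ (proj₂ (proj₂ isP))) (at-zero s)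

      ni : NonIncreasing s
      ni = proj₁ (proj₂ isP)

    reverse-blocks-sorted : All Sorted (reverse (blocks s lam))
    reverse-blocks-sorted = All-reverse (sortedOnBlocks⇒sorted s lam ni len-lam (isP⇒sortedOnBlocks s lam isP))

    length-reverse-blocks : length (reverse (blocks s lam)) ≡ K
    length-reverse-blocks = trans (length-reverse (blocks s lam)) (trans (length-blocks s lam) (proj₁ isP))

    boundaries-reverse²-blocks : boundaries (reverse (reverse (blocks s lam))) ≡ s
    boundaries-reverse²-blocks rewrite reverse-involutive (blocks s lam) = proj₁ (boundaries-blocks s lam ni len-lam)

    joinBlocks-reverse²-blocks : joinBlocks (reverse (reverse (blocks s lam))) ≡ lam
    joinBlocks-reverse²-blocks rewrite reverse-involutive (blocks s lam) = proj₂ (boundaries-blocks s lam ni len-lam)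

  wordOf : P r → List ℕ
  wordOf ((s , lam) , _) = build K (reverse (blocks s lam))

  wordOf-admissible : ∀ x → Admissible K (wordOf x)
  wordOf-admissible (_ , isP) = build-admissible K _ (reverse-blocks-sorted _ _ isP) (length-reverse-blocks _ _ isP)

  Φ : P r → A r
  Φ x = partitionOf (wordOf x) , admissible⇒isA (wordOf-admissible x)

  Ψ : List ℕ → List ℕ × List ℕ
  Ψ y = boundaries (reverse νs) , joinBlocks (reverse νs)
    where νs = unbuild K (multiplicities y)

  Ψ-Φ : ∀ x → Ψ (proj₁ (Φ x)) ≡ proj₁ x
  Ψ-Φ ((s , lam) , isP) = cong₂ _,_ (trans (cong (boundaries ∘ reverse) unbuild≡) (boundaries-reverse²-blocks s lam isP))
                                    (trans (cong (joinBlocks ∘ reverse) unbuild≡) (joinBlocks-reverse²-blocks s lam isP))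
    where
      unbuild≡ : unbuild K (multiplicities (partitionOf (wordOf ((s , lam) , isP)))) ≡ reverse (blocks s lam)
      unbuild≡ = trans (unbuild-≈ K (multiplicities-partitionOf (wordOf ((s , lam) , isP))))
                       (unbuild-build K _ (reverse-blocks-sorted _ _ isP) (length-reverse-blocks _ _ isP))

  module _ {y : List ℕ} (isA : IsA r y) where
    private
      νs = unbuild K (multiplicities y)
      blocks-Ψ : blocks (boundaries (reverse νs)) (joinBlocks (reverse νs)) ≡ reverse νs
      blocks-Ψ = blocks-boundaries (reverse νs)

    Ψ-isP : IsP r (proj₁ (Ψ y)) (proj₂ (Ψ y))
    Ψ-isP =
      trans (length-boundaries (reverse νs)) (trans (length-reverse νs) (length-unbuild K (multiplicities y))) ,
      boundaries-nonIncreasing (reverse νs) ,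
      trans (length-joinBlocks (reverse νs)) (sym (at-zero (boundaries (reverse νs)))) ,
      sortedOnBlocks⇒mono _ (joinBlocks (reverse νs)) (sorted⇒sortedOnBlocks _ (joinBlocks (reverse νs))
        (boundaries-nonIncreasing (reverse νs)) (length-joinBlocks (reverse νs))
        (subst (All Sorted) (sym blocks-Ψ) (All-reverse (unbuild-sorted K (multiplicities y) (isA⇒admissible isA)))))

    Φ-Ψ : proj₁ (Φ ((Ψ y) , Ψ-isP)) ≡ y
    Φ-Ψ = begin
      partitionOf (build K (reverse (blocks (boundaries (reverse νs)) (joinBlocks (reverse νs)))))
        ≡⟨ cong (partitionOf ∘ build K) (trans (cong reverse blocks-Ψ) (reverse-involutive νs)) ⟩
      partitionOf (build K νs)
        ≡⟨ partitionOf-≈ (build-unbuild K (multiplicities y) (isA⇒admissible isA)) ⟩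
      partitionOf (multiplicities y)
        ≡⟨ partitionOf-multiplicities y (proj₁ isA) ⟩
      y ∎
      where open ≡-Reasoning

  weight-Φ : ∀ x → weight (proj₁ (Φ x)) ≡ weightP r x
  weight-Φ x@((s , lam) , isP) = begin
    weight (partitionOf (wordOf x))
      ≡⟨ weight-partitionOf (wordOf x) ⟩
    wordWeight (build K (reverse (blocks s lam)))
      ≡⟨ wordWeight-build K _ (reverse-blocks-sorted s lam isP) (length-reverse-blocks s lam isP) ⟩
    sum (map sumEvens (boundaries (reverse (reverse (blocks s lam))))) + sum (joinBlocks (reverse (reverse (blocks s lam))))
      ≡⟨ cong₂ (λ s′ lam′ → sum (map sumEvens s′) + sum lam′) (boundaries-reverse²-blocks s lam isP) (joinBlocks-reverse²-blocks s lam isP) ⟩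
    sum (map sumEvens s) + sum lam
      ≡⟨ cong (_+ sum lam) (weight-mu s (proj₁ (proj₂ isP))) ⟨
    weight (mu s) + sum lam ∎
    where open ≡-Reasoning

  length-Φ : ∀ x → length (proj₁ (Φ x)) ≡ lengthP r x
  length-Φ x@((s , lam) , isP) = begin
    length (partitionOf (wordOf x))                        ≡⟨ length-partitionOf (wordOf x) ⟩
    sum (build K (reverse (blocks s lam)))                 ≡⟨ sum-build K _ (reverse-blocks-sorted s lam isP) (length-reverse-blocks s lam isP) ⟩
    sum (boundaries (reverse (reverse (blocks s lam))))    ≡⟨ cong sum (boundaries-reverse²-blocks s lam isP) ⟩
    sum s                                                  ≡⟨ length-mu s (proj₁ (proj₂ isP)) ⟨
    length (mu s)                                          ∎
    where open ≡-Reasoning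

mainTheorem1 : (r : ℕ) → 2 ≤ r →
    Σ (P r → A r) λ Φ →
      -- injective (elements compared by their underlying data)
      (∀ x y → proj₁ (Φ x) ≡ proj₁ (Φ y) → proj₁ x ≡ proj₁ y)
      -- surjective
      × (∀ (y : A r) → Σ (P r) λ x → proj₁ (Φ x) ≡ proj₁ y)
      -- preserves weight and length
      × (∀ x → weight (proj₁ (Φ x)) ≡ weightP r x)
      × (∀ x → length (proj₁ (Φ x)) ≡ lengthP r x)
mainTheorem1 (suc zero)    (s≤s ())
mainTheorem1 (suc (suc k)) _ = Φ , injective , surjective , weight-Φ , length-Φ
  where
    open Bijection k
    injective : ∀ x y → proj₁ (Φ x) ≡ proj₁ (Φ y) → proj₁ x ≡ proj₁ y
    injective x y Φx≡Φy = trans (sym (Ψ-Φ x)) (trans (cong Ψ Φx≡Φy) (Ψ-Φ y))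
    surjective : ∀ (y : A r) → Σ (P r) λ x → proj₁ (Φ x) ≡ proj₁ y
    surjective (y , isA) = (Ψ y , Ψ-isP isA) , Φ-Ψ isA
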